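{- Let $N$ be a binary phylogenetic network on $X$ and let $N'$ be any leaf-reconstruction of $N$. Then $N$ and $N'$ have the same number of edges, the same number of vertices, the same reticulation number and the same level.
   Context: $X$ is a finite set with $|X|\ge 2$. A phylogenetic tree on $X$ is a tree with no degree-2 vertices whose leaves (degree-1 vertices) are bijectively labelled by the elements of $X$. A blob of a graph is a maximal 2-connected subgraph with at least two edges. A phylogenetic network on $X$ is a connected graph $N$ such that contracting each blob into a single vertex yields a phylogenetic tree on $X$. A pseudo-network on $X$ is a multigraph with no degree-2 vertices whose leaves are bijectively labelled by $X$; it is binary if every non-leaf vertex has degree 3. Two pseudo-networks are equivalent ($\sim$) if there is a graph isomorphism between them that is the identity on $X$. For a phylogenetic network $N$ and a vertex $v$, $N_v$ is the pseudo-network obtained by deleting $v$ with its incident edges and suppressing resulting degree-2 vertices. A leaf-reconstruction of a phylogenetic network $N$ on $X$ is a phylogenetic network $N'$ on $X$ with $V(N')=V(N)$ and $N'_x\sim N_x$ for all $x\in X$. The reticulation number of a pseudo-network is $|E|-|V|+1$; the level of a network is the maximum reticulation number of its biconnected components. -}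

module Defs where

open import Level using (0ℓ)
open import Data.Nat using (ℕ; zero; suc; _+_; _≤_)
open import Data.Integer as ℤ using (ℤ; +_)
open import Data.Fin using (Fin; zero; suc; inject₁; fromℕ; _≟_)
open import Data.Fin.Subset as S using (Subset; _∈_; _⊆_; ∣_∣; inside; outside)
open import Data.Vec using (_[_]≔_)
open import Data.List using (List; []; _∷_; map; filter; allFin)
open import Data.List.Relation.Binary.Permutation.Propositional using (_↭_)
open import Data.List.Relation.Binary.Pointwise using (Pointwise)
open import Data.Product using (Σ; ∃; ∃-syntax; _×_; _,_; proj₁; proj₂; swap)
open import Data.Product using () renaming (map to ×-map)
open import Data.Sum using (_⊎_)
open import Data.Empty using (⊥)
open import Data.Unit using () renaming (⊤ to Unit)
open import Function using (_∘_)
open import Function.Definitions using (Injective)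
open import Relation.Nullary using (¬_; Dec; yes; no)
open import Relation.Nullary.Decidable using (¬?; _⊎-dec_)
open import Relation.Binary.PropositionalEquality using (_≡_; _≢_)
open import Relation.Binary.Construct.Closure.ReflexiveTransitive using (Star)

sumFin : (m : ℕ) → (Fin m → ℕ) → ℕ
sumFin zero    f = 0
sumFin (suc m) f = f zero + sumFin m (f ∘ suc)

ind : {A : Set} → Dec A → ℕ
ind (yes _) = 1
ind (no  _) = 0

infix 2 _⇔_
_⇔_ : Set → Set → Set
A ⇔ B = (A → B) × (B → A)

UEq : {A : Set} → A × A → A × A → Set
UEq p q = p ≡ q ⊎ p ≡ swap q

-- Graphs with vertex set Fin n and (indexed) edges Fin m;
-- an edge e has endpoints  ends e  (unordered; the pair order is irrelevant).

module _ {n m : ℕ} (ends : Fin m → Fin n × Fin n) where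

  -- degree (a loop would count twice)
  deg : Fin n → ℕ
  deg v = sumFin m (λ e → ind (proj₁ (ends e) ≟ v) + ind (proj₂ (ends e) ≟ v))

  Joins : Fin m → Fin n → Fin n → Set
  Joins e u w = UEq (ends e) (u , w)

  Adj : Fin n → Fin n → Set
  Adj u w = ∃[ e ] Joins e u w

  data Walk (P : Fin n → Set) (Q : Fin m → Set) : Fin n → Fin n → Set where
    here : ∀ {u} → P u → Walk P Q u u
    step : ∀ {u w v} (e : Fin m) → P u → Q e → Joins e u w → Walk P Q w v → Walk P Q u v

  Simple : Set
  Simple = (∀ e → proj₁ (ends e) ≢ proj₂ (ends e))
         × (∀ e f → UEq (ends e) (ends f) → e ≡ f)

  Connected : Set
  Connected = ∀ u v → Walk (λ _ → Unit) (λ _ → Unit) u v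

  -- no cycle  v₀ v₁ … v_{j+2} v₀  with at least 3 distinct vertices
  NoCycle : Set
  NoCycle = ∀ (j : ℕ) (cyc : Fin (3 + j) → Fin n) → Injective _≡_ _≡_ cyc
          → (∀ (i : Fin (2 + j)) → Adj (cyc (inject₁ i)) (cyc (suc i)))
          → Adj (cyc (fromℕ (2 + j))) (cyc zero) → ⊥

  WellFormed : Subset n → Subset m → Set
  WellFormed VS ES = ∀ e → e ∈ ES → proj₁ (ends e) ∈ VS × proj₂ (ends e) ∈ VS

  ConnSub : Subset n → Subset m → Set
  ConnSub VS ES = ∀ u v → u ∈ VS → v ∈ VS → Walk (_∈ VS) (_∈ ES) u v

  TwoConnSub : Subset n → Subset m → Set
  TwoConnSub VS ES = ConnSub VS ES
    × (∀ z → z ∈ VS → ∀ u v → u ∈ VS → v ∈ VS → u ≢ z → v ≢ z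
         → Walk (λ w → w ∈ VS × w ≢ z) (_∈ ES) u v)

  MaxTwoConn : ℕ → Subset n → Subset m → Set
  MaxTwoConn b VS ES = WellFormed VS ES × TwoConnSub VS ES × b ≤ ∣ ES ∣
    × (∀ VS' ES' → WellFormed VS' ES' → TwoConnSub VS' ES' → VS ⊆ VS' → ES ⊆ ES'
         → VS' ≡ VS × ES' ≡ ES)

  Blob : Subset n → Subset m → Set
  Blob = MaxTwoConn 2

  BiComp : Subset n → Subset m → Set
  BiComp = MaxTwoConn 1

  SameBlob : Fin n → Fin n → Set
  SameBlob u v = ∃[ VS ] ∃[ ES ] (Blob VS ES × u ∈ VS × v ∈ VS)

  InBlob : Fin m → Set
  InBlob e = ∃[ VS ] ∃[ ES ] (Blob VS ES × e ∈ ES)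

  -- the graph on Fin t with edges endsT obtained by contracting every blob
  -- into a single vertex (c sends a vertex to its image; d sends each
  -- remaining edge to the original, non-blob edge)
  record BlobContraction (t mt : ℕ) : Set where
    field
      endsT  : Fin mt → Fin t × Fin t
      c      : Fin n → Fin t
      c-surj : ∀ w → ∃[ v ] c v ≡ w
      c-ker  : ∀ u v → (c u ≡ c v) ⇔ Star SameBlob u v
      d      : Fin mt → Fin m
      d-inj  : Injective _≡_ _≡_ d
      d-img  : ∀ e → (¬ InBlob e) ⇔ (∃[ i ] d i ≡ e)
      d-ends : ∀ i → endsT i ≡ ×-map c c (ends (d i))

  retSub : Subset n → Subset m → ℤ
  retSub VS ES = (+ ∣ ES ∣ ℤ.- + ∣ VS ∣) ℤ.+ + 1

  IsLevel : ℤ → Set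
  IsLevel l = (∀ VS ES → BiComp VS ES → retSub VS ES ℤ.≤ l)
            × (∃[ VS ] ∃[ ES ] (BiComp VS ES × retSub VS ES ≡ l))

retNum : ℕ → ℕ → ℤ
retNum n m = (+ m ℤ.- + n) ℤ.+ + 1

LeafLabelling : {k n m : ℕ} → (Fin m → Fin n × Fin n) → (Fin k → Fin n) → Set
LeafLabelling ends lab = Injective _≡_ _≡_ lab × (∀ v → deg ends v ≡ 1 ⇔ (∃[ x ] lab x ≡ v))

PhyloTree : {k t mt : ℕ} → (Fin mt → Fin t × Fin t) → (Fin k → Fin t) → Set
PhyloTree endsT labT = Connected endsT × Simple endsT × NoCycle endsT
  × (∀ v → deg endsT v ≢ 2) × LeafLabelling endsT labT

PhyloNetwork : {k n m : ℕ} → (Fin m → Fin n × Fin n) → (Fin k → Fin n) → Set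
PhyloNetwork {k} {n} {m} ends lab = Connected ends × Simple ends × LeafLabelling ends lab
  × ∃[ t ] ∃[ mt ] Σ (BlobContraction ends t mt) (λ C →
      PhyloTree (BlobContraction.endsT C) (BlobContraction.c C ∘ lab))

BinaryPhyloNetwork : {k n m : ℕ} → (Fin m → Fin n × Fin n) → (Fin k → Fin n) → Set
BinaryPhyloNetwork ends lab = PhyloNetwork ends lab × (∀ v → deg ends v ≡ 1 ⊎ deg ends v ≡ 3)

-- Pseudo-networks arising from deleting a vertex and suppressing degree-2
-- vertices.  A state is a multigraph whose vertices are the 'alive' elements
-- of Fin n and whose edges form a list (loops and parallel edges allowed).

record PState (n : ℕ) : Set where
  constructor pstate
  field
    alive : Subset n
    edges : List (Fin n × Fin n)
open PState public

degL : {n : ℕ} → List (Fin n × Fin n) → Fin n → ℕ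
degL []             v = 0
degL ((a , b) ∷ es) v = ind (a ≟ v) + ind (b ≟ v) + degL es v

deleteV : {n m : ℕ} → (Fin m → Fin n × Fin n) → Fin n → PState n
deleteV {n} {m} ends v = pstate (S.⊤ [ v ]≔ outside)
  (filter (λ p → ¬? ((proj₁ p ≟ v) ⊎-dec (proj₂ p ≟ v))) (map ends (allFin m)))

SuppStep : {n : ℕ} → PState n → PState n → Set
SuppStep {n} P P' = Σ (Fin n) λ u → u ∈ alive P × degL (edges P) u ≡ 2
  × Σ (Fin n) λ a → Σ (Fin n) λ b → Σ (Fin n × Fin n) λ e₁ → Σ (Fin n × Fin n) λ e₂ →
    Σ (List (Fin n × Fin n)) λ rest →
      UEq e₁ (a , u) × UEq e₂ (u , b) × (edges P ↭ e₁ ∷ e₂ ∷ rest)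
      × edges P' ≡ (a , b) ∷ rest × alive P' ≡ alive P [ u ]≔ outside

Suppressed : {n : ℕ} → PState n → PState n → Set
Suppressed P P' = Star SuppStep P P' × (∀ v → v ∈ alive P' → degL (edges P') v ≢ 2)

-- isomorphism of pseudo-networks on X ∖ {x}, identity on the labels
PIso : {k n n' : ℕ} → PState n → PState n' → (Fin k → Fin n) → (Fin k → Fin n') → Fin k → Set
PIso {k} {n} {n'} P P' lab lab' x =
  Σ (Fin n → Fin n') λ φ → Σ (Fin n' → Fin n) λ ψ →
    (∀ v → v ∈ alive P → φ v ∈ alive P' × ψ (φ v) ≡ v)
  × (∀ w → w ∈ alive P' → ψ w ∈ alive P × φ (ψ w) ≡ w)
  × (∃[ es ] (Pointwise (λ e f → UEq (×-map φ φ e) f) (edges P) es × es ↭ edges P'))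
  × (∀ y → y ≢ x → φ (lab y) ≡ lab' y)

LeafDelEquiv : {k n m n' m' : ℕ}
  → (Fin m → Fin n × Fin n) → (Fin k → Fin n)
  → (Fin m' → Fin n' × Fin n') → (Fin k → Fin n') → Fin k → Set
LeafDelEquiv {n = n} {n' = n'} ends lab ends' lab' x =
  Σ (PState n) λ P → Σ (PState n') λ P' →
    Suppressed (deleteV ends (lab x)) P × Suppressed (deleteV ends' (lab' x)) P'
    × PIso P P' lab lab' x

LeafReconstruction : {k n m m' : ℕ}
  → (Fin m → Fin n × Fin n) → (Fin k → Fin n)
  → (Fin m' → Fin n × Fin n) → (Fin k → Fin n) → Set
LeafReconstruction ends lab ends' lab' =
  PhyloNetwork ends' lab' × (∀ x → LeafDelEquiv ends lab ends' lab' x)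

module Submission where

-- Fix a leaf x and let P, P′ be the pseudo-networks obtained from N and N′ by
-- deleting x and suppressing degree-2 vertices; by assumption P ≅ P′.  Deleting
-- a leaf removes one vertex and one edge, each suppression step one more of
-- each; as N and N′ share their vertex set and P, P′ have equal sizes, the
-- numbers of steps agree and so do the edge counts (reconstruction-sizes);
-- equal reticulation numbers follow.
--
-- For the level, let w be the neighbour of x in N.  If w is a leaf, N and N′
-- are single edges of level 0.  Otherwise deg w = 3 and the suppression is the
-- single step at w, in N and hence in N′.  The level is invariant under
-- isomorphism, under adding a pendant edge and under subdividing an edge, each
-- shown by a ret-preserving correspondence of blobs and biconnected components;
-- so N, P, P′ and N′ share the level of N, which exists since N has a
-- biconnected component (the edge at x).

open import Defs
open import Data.Nat using (ℕ; zero; suc; _+_; _≤_; _<_; z≤n; s≤s)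
import Data.Nat.Properties as ℕP
import Data.Integer as ℤ
import Data.Integer.Properties as ℤP
open import Data.Fin using (Fin; zero; suc; _≟_; cast)
open import Data.Fin.Properties using (suc-injective; any?; all?; cast-involutive)
open import Data.Fin.Subset as S using (Subset; _∈_; _∉_; _⊆_; ∣_∣; inside; outside)
open import Data.Fin.Subset.Properties using (_∈?_; _⊆?_; ⊆-antisym; ∈⊤; drop-there; x∈⁅x⁆; x∈⁅y⁆⇒x≡y; ∣⁅x⁆∣≡1; ∣⊤∣≡n; ∣p∣≤n; p⊆q⇒∣p∣≤∣q∣; anySubset?)
open import Data.Bool using (Bool; if_then_else_)
import Data.Bool as Bool
open import Data.Vec using ([]; _∷_; tail; _[_]≔_; here; there)
import Data.Vec.Properties as VecP
open import Data.List using (List; []; _∷_; length; lookup; tabulate; filter; map; allFin; _++_; cartesianProduct)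
open import Data.List.Properties using (map-tabulate; length-tabulate; lookup-tabulate)
open import Data.List.Membership.Propositional using () renaming (_∈_ to _∈L_)
open import Data.List.Membership.Propositional.Properties using (∈-map⁺; ∈-++⁺ˡ; ∈-++⁺ʳ; ∈-cartesianProduct⁺; ∈-filter⁺; ∈-filter⁻)
import Data.List.Relation.Unary.Any as Any
open import Data.List.Relation.Unary.All using (All; []; _∷_)
open import Data.List.Relation.Unary.All.Properties using (all-filter) renaming (filter⁺ to All-filter⁺; tabulate⁺ to All-tabulate⁺)
open import Data.List.Relation.Unary.AllPairs using (AllPairs; []; _∷_)
import Data.List.Relation.Unary.AllPairs.Properties as AllPairsP
open import Data.List.Relation.Binary.Pointwise using (Pointwise; []; _∷_)
open import Data.List.Relation.Binary.Pointwise.Properties using (Pointwise-length)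
open import Data.List.Relation.Binary.Permutation.Propositional using (_↭_; ↭-sym; ↭-reflexive)
import Data.List.Relation.Binary.Permutation.Propositional as Perm
open import Data.List.Relation.Binary.Permutation.Propositional.Properties using (All-resp-↭; ↭-length; shift)
open import Data.Product using (Σ; ∃-syntax; _×_; _,_; proj₁; proj₂)
open import Data.Product using () renaming (map to ×-map)
open import Data.Product.Properties using () renaming (≡-dec to ×-≡-dec)
open import Data.Sum using (_⊎_; inj₁; inj₂; [_,_]′)
open import Data.Empty using (⊥; ⊥-elim)
open import Data.Unit using (⊤; tt)
open import Function using (_∘_; id)
open import Relation.Nullary using (¬_; Dec; yes; no; does)
open import Relation.Nullary.Decidable using (_×-dec_; _⊎-dec_; _→-dec_; ¬?)
open import Relation.Binary.PropositionalEquality using (_≡_; _≢_; refl; sym; trans; cong; cong₂; subst; module ≡-Reasoning)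
open import Relation.Binary.Construct.Closure.ReflexiveTransitive using (Star; ε; _◅_)
import Data.List.Extrema ℤP.≤-totalOrder as Extrema

∈-remove⁻ : ∀ {n} {p : Subset n} {x y} → x ∈ p [ y ]≔ outside → x ∈ p × x ≢ y
∈-remove⁻ {p = b ∷ p} {zero}  {zero}  ()
∈-remove⁻ {p = b ∷ p} {zero}  {suc y} here      = here , λ ()
∈-remove⁻ {p = b ∷ p} {suc x} {zero}  (there q) = there q , λ ()
∈-remove⁻ {p = b ∷ p} {suc x} {suc y} (there q) with ∈-remove⁻ {p = p} q
... | q′ , x≢y = there q′ , λ e → x≢y (suc-injective e)

∈-remove⁺ : ∀ {n} {p : Subset n} {x y} → x ∈ p → x ≢ y → x ∈ p [ y ]≔ outside
∈-remove⁺ {p = b ∷ p} {zero}  {zero}  q         x≢y = ⊥-elim (x≢y refl)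
∈-remove⁺ {p = b ∷ p} {zero}  {suc y} here      x≢y = here
∈-remove⁺ {p = b ∷ p} {suc x} {zero}  (there q) x≢y = there q
∈-remove⁺ {p = b ∷ p} {suc x} {suc y} (there q) x≢y = there (∈-remove⁺ q (x≢y ∘ cong suc))

∈-insert⁻ : ∀ {n} {p : Subset n} {x y} → x ∈ p [ y ]≔ inside → x ∈ p ⊎ x ≡ y
∈-insert⁻ {p = b ∷ p} {zero}  {zero}  here      = inj₂ refl
∈-insert⁻ {p = b ∷ p} {zero}  {suc y} here      = inj₁ here
∈-insert⁻ {p = b ∷ p} {suc x} {zero}  (there q) = inj₁ (there q)
∈-insert⁻ {p = b ∷ p} {suc x} {suc y} (there q) with ∈-insert⁻ {p = p} q
... | inj₁ r = inj₁ (there r)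
... | inj₂ e = inj₂ (cong suc e)

∈-insert⁺ : ∀ {n} {p : Subset n} {x y} → x ∈ p → x ∈ p [ y ]≔ inside
∈-insert⁺ {p = b ∷ p} {zero}  {zero}  q         = here
∈-insert⁺ {p = b ∷ p} {zero}  {suc y} here      = here
∈-insert⁺ {p = b ∷ p} {suc x} {zero}  (there q) = there q
∈-insert⁺ {p = b ∷ p} {suc x} {suc y} (there q) = there (∈-insert⁺ q)

∈-inserted : ∀ {n} {p : Subset n} {y} → y ∈ p [ y ]≔ inside
∈-inserted {p = b ∷ p} {zero}  = here
∈-inserted {p = b ∷ p} {suc y} = there ∈-inserted

subsetOf : ∀ {n} {P : Fin n → Set} → (∀ x → Dec (P x)) → Subset n
subsetOf {zero}  P? = []
subsetOf {suc n} P? = (if does (P? zero) then inside else outside) ∷ subsetOf (P? ∘ suc)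

subsetOf⁻ : ∀ {n} {P : Fin n → Set} (P? : ∀ x → Dec (P x)) {x} → x ∈ subsetOf P? → P x
subsetOf⁻ {suc n} P? {zero} q with P? zero
subsetOf⁻ {suc n} P? {zero} here | yes px = px
subsetOf⁻ {suc n} P? {suc x} (there q) = subsetOf⁻ (P? ∘ suc) q

subsetOf⁺ : ∀ {n} {P : Fin n → Set} (P? : ∀ x → Dec (P x)) {x} → P x → x ∈ subsetOf P?
subsetOf⁺ {suc n} P? {zero} px with P? zero
... | yes _  = here
... | no ¬px = ⊥-elim (¬px px)
subsetOf⁺ {suc n} P? {suc x} px = there (subsetOf⁺ (P? ∘ suc) px)

∣remove∣ : ∀ {n} {p : Subset n} {x} → x ∈ p → suc ∣ p [ x ]≔ outside ∣ ≡ ∣ p ∣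
∣remove∣ {p = inside ∷ p}  {zero}  here      = refl
∣remove∣ {p = outside ∷ p} {suc x} (there q) = ∣remove∣ q
∣remove∣ {p = inside ∷ p}  {suc x} (there q) = cong suc (∣remove∣ q)

∣remove-∉∣ : ∀ {n} {p : Subset n} {x} → x ∉ p → ∣ p [ x ]≔ outside ∣ ≡ ∣ p ∣
∣remove-∉∣ {p = outside ∷ p} {zero}  x∉ = refl
∣remove-∉∣ {p = inside ∷ p}  {zero}  x∉ = ⊥-elim (x∉ here)
∣remove-∉∣ {p = outside ∷ p} {suc x} x∉ = ∣remove-∉∣ (x∉ ∘ there)
∣remove-∉∣ {p = inside ∷ p}  {suc x} x∉ = cong suc (∣remove-∉∣ (x∉ ∘ there))

∣insert∣ : ∀ {n} {p : Subset n} {x} → x ∉ p → ∣ p [ x ]≔ inside ∣ ≡ suc ∣ p ∣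
∣insert∣ {p = outside ∷ p} {zero}  x∉ = refl
∣insert∣ {p = inside ∷ p}  {zero}  x∉ = ⊥-elim (x∉ here)
∣insert∣ {p = outside ∷ p} {suc x} x∉ = ∣insert∣ (x∉ ∘ there)
∣insert∣ {p = inside ∷ p}  {suc x} x∉ = cong suc (∣insert∣ (x∉ ∘ there))

injection-∣≤∣ : ∀ {n n'} (p : Subset n) (q : Subset n') (φ : Fin n → Fin n')
  → (∀ v → v ∈ p → φ v ∈ q)
  → (∀ u v → u ∈ p → v ∈ p → φ u ≡ φ v → u ≡ v)
  → ∣ p ∣ ≤ ∣ q ∣
injection-∣≤∣ []            q φ into inj = z≤n
injection-∣≤∣ (outside ∷ p) q φ into inj =
  injection-∣≤∣ p q (φ ∘ suc) (λ v v∈ → into (suc v) (there v∈))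
    (λ u v u∈ v∈ e → suc-injective (inj (suc u) (suc v) (there u∈) (there v∈) e))
injection-∣≤∣ (inside ∷ p)  q φ into inj = ℕP.≤-trans (s≤s rest) (ℕP.≤-reflexive (∣remove∣ (into zero here)))
  where
  suc≢zero : ∀ {n} {v : Fin n} → suc v ≢ zero
  suc≢zero ()
  -- the other members of p land in q without φ zero
  rest : ∣ p ∣ ≤ ∣ q [ φ zero ]≔ outside ∣
  rest = injection-∣≤∣ p (q [ φ zero ]≔ outside) (φ ∘ suc)
    (λ v v∈ → ∈-remove⁺ (into (suc v) (there v∈)) (suc≢zero ∘ inj (suc v) zero (there v∈) here))
    (λ u v u∈ v∈ e → suc-injective (inj (suc u) (suc v) (there u∈) (there v∈) e))

bijection-∣≡∣ : ∀ {n n'} (p : Subset n) (q : Subset n') (φ : Fin n → Fin n') (ψ : Fin n' → Fin n)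
  → (∀ v → v ∈ p → φ v ∈ q × ψ (φ v) ≡ v) → (∀ w → w ∈ q → ψ w ∈ p × φ (ψ w) ≡ w)
  → ∣ p ∣ ≡ ∣ q ∣
bijection-∣≡∣ p q φ ψ pq qp = ℕP.≤-antisym
  (injection-∣≤∣ p q φ (λ v → proj₁ ∘ pq v)
     (λ u v u∈ v∈ e → trans (sym (proj₂ (pq u u∈))) (trans (cong ψ e) (proj₂ (pq v v∈)))))
  (injection-∣≤∣ q p ψ (λ w → proj₁ ∘ qp w)
     (λ u v u∈ v∈ e → trans (sym (proj₂ (qp u u∈))) (trans (cong φ e) (proj₂ (qp v v∈)))))

nonempty : ∀ {n} (p : Subset n) → 1 ≤ ∣ p ∣ → ∃[ x ] x ∈ p
nonempty (inside ∷ p)  _ = zero , here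
nonempty (outside ∷ p) h with nonempty p h
... | x , x∈ = suc x , there x∈

member-≢ : ∀ {n} (p : Subset n) → 2 ≤ ∣ p ∣ → ∀ y → ∃[ x ] (x ∈ p × x ≢ y)
member-≢ p h y with y ∈? p
... | no y∉ with nonempty p (ℕP.≤-trans (s≤s z≤n) h)
...   | x , x∈ = x , x∈ , λ e → y∉ (subst (_∈ p) e x∈)
member-≢ p h y | yes y∈ with nonempty (p [ y ]≔ outside)
                               (ℕP.+-cancelˡ-≤ 1 1 _ (subst (2 ≤_) (sym (∣remove∣ y∈)) h))
... | x , x∈ = x , ∈-remove⁻ x∈

∣⊆pair∣≤2 : ∀ {n} (p : Subset n) y z → (∀ x → x ∈ p → x ≡ y ⊎ x ≡ z) → ∣ p ∣ ≤ 2
∣⊆pair∣≤2 p y z ⊆yz = injection-∣≤∣ p (S.⊤ {2}) code (λ _ _ → ∈⊤) inj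
  where
  code : Fin _ → Fin 2
  code x with x ≟ y
  ... | yes _ = zero
  ... | no  _ = suc zero
  inj : ∀ u v → u ∈ p → v ∈ p → code u ≡ code v → u ≡ v
  inj u v u∈ v∈ e with u ≟ y | v ≟ y | ⊆yz u u∈ | ⊆yz v v∈
  inj u v u∈ v∈ () | yes _ | no _  | _ | _
  inj u v u∈ v∈ () | no _  | yes _ | _ | _
  ... | yes u≡y | yes v≡y | _ | _ = trans u≡y (sym v≡y)
  ... | no u≢y | _ | inj₁ u≡y | _ = ⊥-elim (u≢y u≡y)
  ... | _ | no v≢y | _ | inj₁ v≡y = ⊥-elim (v≢y v≡y)
  ... | _ | _ | inj₂ u≡z | inj₂ v≡z = trans u≡z (sym v≡z)

∣⊇pair∣≥2 : ∀ {n} (p : Subset n) y z → y ∈ p → z ∈ p → y ≢ z → 2 ≤ ∣ p ∣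
∣⊇pair∣≥2 p y z y∈ z∈ y≢z = subst (2 ≤_) (∣remove∣ y∈)
  (s≤s (subst (1 ≤_) (∣remove∣ (∈-remove⁺ z∈ (y≢z ∘ sym))) (s≤s z≤n)))

module Graph {n m : ℕ} (ends : Fin m → Fin n × Fin n) where

  Touches : Fin m → Fin n → Set
  Touches e v = proj₁ (ends e) ≡ v ⊎ proj₂ (ends e) ≡ v

  Loopless : Set
  Loopless = ∀ e → proj₁ (ends e) ≢ proj₂ (ends e)

  joins-sym : ∀ {e u w} → Joins ends e u w → Joins ends e w u
  joins-sym (inj₁ eq) = inj₂ eq
  joins-sym (inj₂ eq) = inj₁ eq

  joins-touches₁ : ∀ {e u w} → Joins ends e u w → Touches e u
  joins-touches₁ (inj₁ eq) = inj₁ (cong proj₁ eq)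
  joins-touches₁ (inj₂ eq) = inj₂ (cong proj₂ eq)

  joins-touches₂ : ∀ {e u w} → Joins ends e u w → Touches e w
  joins-touches₂ = joins-touches₁ ∘ joins-sym

  joins-ends : ∀ {e u w} → Joins ends e u w
    → (proj₁ (ends e) ≡ u × proj₂ (ends e) ≡ w) ⊎ (proj₁ (ends e) ≡ w × proj₂ (ends e) ≡ u)
  joins-ends (inj₁ eq) = inj₁ (cong proj₁ eq , cong proj₂ eq)
  joins-ends (inj₂ eq) = inj₂ (cong proj₁ eq , cong proj₂ eq)

  joins-other : ∀ {e u w y z} → Joins ends e y z → Joins ends e u w → u ≡ y → w ≡ z
  joins-other (inj₁ a) (inj₁ b) refl = cong proj₂ (trans (sym b) a)
  joins-other (inj₁ a) (inj₂ b) refl = let c = trans (sym b) a in trans (cong proj₁ c) (cong proj₂ c)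
  joins-other (inj₂ a) (inj₁ b) refl = let c = trans (sym b) a in trans (cong proj₂ c) (cong proj₁ c)
  joins-other (inj₂ a) (inj₂ b) refl = cong proj₁ (trans (sym b) a)

  joins-own : ∀ e → Joins ends e (proj₁ (ends e)) (proj₂ (ends e))
  joins-own e = inj₁ refl

  walk-head : ∀ {P Q u v} → Walk ends P Q u v → P u
  walk-head (here pu)          = pu
  walk-head (step e pu _ _ _)  = pu

  walk-last : ∀ {P Q u v} → Walk ends P Q u v → P v
  walk-last (here pv)          = pv
  walk-last (step e _ _ _ r)   = walk-last r

  _++w_ : ∀ {P Q u v w} → Walk ends P Q u v → Walk ends P Q v w → Walk ends P Q u w
  here _           ++w r′ = r′
  step e pu qe j r ++w r′ = step e pu qe j (r ++w r′)

  walk-snoc : ∀ {P Q u v w} → Walk ends P Q u v → ∀ e → Q e → Joins ends e v w → P w → Walk ends P Q u w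
  walk-snoc r e qe j pw = r ++w step e (walk-last r) qe j (here pw)

  walk-reverse : ∀ {P Q u v} → Walk ends P Q u v → Walk ends P Q v u
  walk-reverse (here pu)          = here pu
  walk-reverse (step e pu qe j r) = walk-snoc (walk-reverse r) e qe (joins-sym j) pu

  walk-mono : ∀ {P P′ Q Q′ u v} → (∀ {x} → P x → P′ x) → (∀ {e} → Q e → Q′ e)
    → Walk ends P Q u v → Walk ends P′ Q′ u v
  walk-mono f g (here pu)          = here (f pu)
  walk-mono f g (step e pu qe j r) = step e (f pu) (g qe) j (walk-mono f g r)

  walk-subst : ∀ {P Q u u′ v v′} → u ≡ u′ → v ≡ v′ → Walk ends P Q u v → Walk ends P Q u′ v′
  walk-subst refl refl r = r

  stuck-at-start : ∀ {P Q p t} q → Walk ends P Q p t → p ≢ t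
    → (∀ e w → Q e → Joins ends e p w → w ≡ q) → ¬ P q → ⊥
  stuck-at-start q (here _)           p≢t only-q ¬pq = p≢t refl
  stuck-at-start q (step e _ qe j r)  p≢t only-q ¬pq = ¬pq (subst _ (only-q e _ qe j) (walk-head r))

  walk-within-pair : ∀ {P Q u v} y z → (∀ e → Q e → Joins ends e y z) → Walk ends P Q u v
    → (u ≡ y ⊎ u ≡ z) → (v ≡ y ⊎ v ≡ z)
  walk-within-pair y z yz (here _) at = at
  walk-within-pair y z yz (step e _ qe j r) (inj₁ refl) =
    walk-within-pair y z yz r (inj₂ (joins-other (yz e qe) j refl))
  walk-within-pair y z yz (step e _ qe j r) (inj₂ refl) =
    walk-within-pair y z yz r (inj₁ (joins-other (joins-sym (yz e qe)) j refl))

  -- a well-formed 2-connected subgraph with at least b edges: the candidates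
  -- among which blobs (b = 2) and biconnected components (b = 1) are the maximal ones
  TwoConn : ℕ → Subset n → Subset m → Set
  TwoConn b VS ES = WellFormed ends VS ES × TwoConnSub ends VS ES × b ≤ ∣ ES ∣

  vertex-touched : ∀ {b VS ES} → 1 ≤ b → TwoConn b VS ES → ∀ {v} → v ∈ VS → ∃[ e ] (e ∈ ES × Touches e v)
  vertex-touched 1≤b (wf , (cs , _) , size) {v} v∈ with nonempty _ (ℕP.≤-trans 1≤b size)
  ... | e₀ , e₀∈ with cs v (proj₁ (ends e₀)) v∈ (proj₁ (wf e₀ e₀∈))
  ... | here _             = e₀ , e₀∈ , inj₁ refl
  ... | step e _ e∈ j _    = e , e∈ , joins-touches₁ j

  retSub-by-cards : ∀ VS ES {a b} → ∣ ES ∣ ≡ a → ∣ VS ∣ ≡ b → retSub ends VS ES ≡ (ℤ.+ a ℤ.- ℤ.+ b) ℤ.+ ℤ.+ 1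
  retSub-by-cards VS ES refl refl = refl

  -- a biconnected component with a single (non-loop) edge consists of that edge
  -- and its two ends, so its reticulation number is 1 - 2 + 1 = 0
  single-edge-ret : Loopless → ∀ {VS ES} → BiComp ends VS ES → ∣ ES ∣ ≡ 1 → retSub ends VS ES ≡ ℤ.+ 0
  single-edge-ret loopless {VS} {ES} (wf , (cs , _) , size , _) one with nonempty ES size
  ... | e₀ , e₀∈ = retSub-by-cards VS ES one two-vertices
    where
    y z : Fin n
    y = proj₁ (ends e₀)
    z = proj₂ (ends e₀)
    only-e₀ : ∀ e → e ∈ ES → e ≡ e₀
    only-e₀ e e∈ with e ≟ e₀
    ... | yes e≡e₀ = e≡e₀
    ... | no  e≢e₀ = ⊥-elim (ℕP.<-irrefl refl (ℕP.≤-trans (∣⊇pair∣≥2 ES e e₀ e∈ e₀∈ e≢e₀) (ℕP.≤-reflexive one)))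
    within : ∀ x → x ∈ VS → x ≡ y ⊎ x ≡ z
    within x x∈ = walk-within-pair y z (λ e e∈ → subst (λ e′ → Joins ends e′ y z) (sym (only-e₀ e e∈)) (joins-own e₀))
                    (walk-reverse (cs x y x∈ (proj₁ (wf e₀ e₀∈)))) (inj₁ refl)
    two-vertices : ∣ VS ∣ ≡ 2
    two-vertices = ℕP.≤-antisym (∣⊆pair∣≤2 VS y z within)
                     (∣⊇pair∣≥2 VS y z (proj₁ (wf e₀ e₀∈)) (proj₂ (wf e₀ e₀∈)) (loopless e₀))

  Pendant : Fin n → Fin m → Fin n → Set
  Pendant y e₀ z = Joins ends e₀ y z × y ≢ z × (∀ e → Touches e y → e ≡ e₀)

  module PendantEdge {y e₀ z} (loopless : Loopless) (pendant : Pendant y e₀ z) where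
    private
      j₀ : Joins ends e₀ y z
      j₀ = proj₁ pendant
      y≢z : y ≢ z
      y≢z = proj₁ (proj₂ pendant)
      only-e₀ : ∀ e → Touches e y → e ≡ e₀
      only-e₀ = proj₂ (proj₂ pendant)

    VSp : Subset n
    VSp = S.⁅ y ⁆ [ z ]≔ inside
    ESp : Subset m
    ESp = S.⁅ e₀ ⁆

    y∈ : y ∈ VSp
    y∈ = ∈-insert⁺ (x∈⁅x⁆ y)
    z∈ : z ∈ VSp
    z∈ = ∈-inserted
    e₀∈ : e₀ ∈ ESp
    e₀∈ = x∈⁅x⁆ e₀

    y-or-z : ∀ {x} → x ∈ VSp → x ≡ y ⊎ x ≡ z
    y-or-z x∈ with ∈-insert⁻ x∈
    ... | inj₁ x∈⁅y⁆ = inj₁ (x∈⁅y⁆⇒x≡y y x∈⁅y⁆)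
    ... | inj₂ x≡z   = inj₂ x≡z

    wf : WellFormed ends VSp ESp
    wf e e∈ with x∈⁅y⁆⇒x≡y e₀ e∈
    ... | refl with joins-ends j₀
    ... | inj₁ (a , b) = subst (_∈ VSp) (sym a) y∈ , subst (_∈ VSp) (sym b) z∈
    ... | inj₂ (a , b) = subst (_∈ VSp) (sym a) z∈ , subst (_∈ VSp) (sym b) y∈

    y⇝z : Walk ends (_∈ VSp) (_∈ ESp) y z
    y⇝z = step e₀ y∈ e₀∈ j₀ (here z∈)

    connected : ConnSub ends VSp ESp
    connected u v u∈ v∈ with y-or-z u∈ | y-or-z v∈
    ... | inj₁ refl | inj₁ refl = here u∈
    ... | inj₁ refl | inj₂ refl = y⇝z
    ... | inj₂ refl | inj₁ refl = walk-reverse y⇝z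
    ... | inj₂ refl | inj₂ refl = here u∈

    -- removing one of two vertices leaves a single vertex, trivially connected
    two-connected : TwoConnSub ends VSp ESp
    two-connected = connected , λ x x∈ u v u∈ v∈ u≢x v≢x → subst (Walk ends _ _ u) (same x∈ u∈ v∈ u≢x v≢x) (here (u∈ , u≢x))
      where
      same : ∀ {x u v} → x ∈ VSp → u ∈ VSp → v ∈ VSp → u ≢ x → v ≢ x → u ≡ v
      same x∈ u∈ v∈ u≢x v≢x with y-or-z x∈ | y-or-z u∈ | y-or-z v∈
      ... | _         | inj₁ refl | inj₁ refl = refl
      ... | _         | inj₂ refl | inj₂ refl = refl
      ... | inj₁ refl | inj₁ refl | inj₂ refl = ⊥-elim (u≢x refl)
      ... | inj₂ refl | inj₁ refl | inj₂ refl = ⊥-elim (v≢x refl)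
      ... | inj₁ refl | inj₂ refl | inj₁ refl = ⊥-elim (v≢x refl)
      ... | inj₂ refl | inj₂ refl | inj₁ refl = ⊥-elim (u≢x refl)

    -- any larger 2-connected subgraph would reach beyond y without passing z
    maximal : ∀ VS′ ES′ → WellFormed ends VS′ ES′ → TwoConnSub ends VS′ ES′ → VSp ⊆ VS′ → ESp ⊆ ES′
            → VS′ ≡ VSp × ES′ ≡ ESp
    maximal VS′ ES′ wf′ tc′ VS⊆ ES⊆ = ⊆-antisym VS′⊆ VS⊆ , ⊆-antisym ES′⊆ ES⊆
      where
      VS′⊆ : VS′ ⊆ VSp
      VS′⊆ {r} r∈ with r ≟ y | r ≟ z
      ... | yes refl | _        = y∈
      ... | no _     | yes refl = z∈
      ... | no r≢y   | no r≢z   =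
        ⊥-elim (stuck-at-start z (proj₂ tc′ z (VS⊆ z∈) y r (VS⊆ y∈) r∈ y≢z r≢z) (r≢y ∘ sym) via-z (λ p → proj₂ p refl))
        where
        via-z : ∀ e w → e ∈ ES′ → Joins ends e y w → w ≡ z
        via-z e w _ j with only-e₀ e (joins-touches₁ j)
        ... | refl = joins-other j₀ j refl
      ES′⊆ : ES′ ⊆ ESp
      ES′⊆ {e} e∈ with y-or-z (VS′⊆ (proj₁ (wf′ e e∈))) | y-or-z (VS′⊆ (proj₂ (wf′ e e∈)))
      ... | inj₁ a | _      = subst (_∈ ESp) (sym (only-e₀ e (inj₁ a))) e₀∈
      ... | inj₂ _ | inj₁ b = subst (_∈ ESp) (sym (only-e₀ e (inj₂ b))) e₀∈
      ... | inj₂ a | inj₂ b = ⊥-elim (loopless e (trans a (sym b)))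

    bicomp : BiComp ends VSp ESp
    bicomp = wf , two-connected , ℕP.≤-reflexive (sym (∣⁅x⁆∣≡1 e₀)) , maximal

    ret≡0 : retSub ends VSp ESp ≡ ℤ.+ 0
    ret≡0 = retSub-by-cards VSp ESp (∣⁅x⁆∣≡1 e₀)
      (ℕP.≤-antisym (∣⊆pair∣≤2 VSp y z (λ x → y-or-z)) (∣⊇pair∣≥2 VSp y z y∈ z∈ y≢z))

  ZeroBiComp : Set
  ZeroBiComp = ∃[ VS ] ∃[ ES ] (BiComp ends VS ES × retSub ends VS ES ≡ ℤ.+ 0)

  pendant-bicomp : Loopless → ∀ {y e₀ z} → Pendant y e₀ z → ZeroBiComp
  pendant-bicomp loopless pendant = _ , _ , bicomp , ret≡0
    where open PendantEdge loopless pendant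

-- The level is determined by the reticulation numbers of
-- the biconnected components, so a ret-preserving correspondence of biconnected
-- components in both directions identifies the levels of two graphs.

SameLevel : ∀ {n n′ m m′} → (Fin m → Fin n × Fin n) → (Fin m′ → Fin n′ × Fin n′) → Set
SameLevel ends₁ ends₂ = ∀ {l} → IsLevel ends₁ l ⇔ IsLevel ends₂ l

SameLevel-sym : ∀ {n n′ m m′} {ends₁ : Fin m → Fin n × Fin n} {ends₂ : Fin m′ → Fin n′ × Fin n′}
  → SameLevel ends₁ ends₂ → SameLevel ends₂ ends₁
SameLevel-sym same = proj₂ same , proj₁ same

SameLevel-trans : ∀ {n₁ n₂ n₃ m₁ m₂ m₃} {ends₁ : Fin m₁ → Fin n₁ × Fin n₁}
  {ends₂ : Fin m₂ → Fin n₂ × Fin n₂} {ends₃ : Fin m₃ → Fin n₃ × Fin n₃}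
  → SameLevel ends₁ ends₂ → SameLevel ends₂ ends₃ → SameLevel ends₁ ends₃
SameLevel-trans s t = proj₁ t ∘ proj₁ s , proj₂ s ∘ proj₂ t

BiCompTransfer : ∀ {n m₁ m₂} (ends₁ : Fin m₁ → Fin n × Fin n) (ends₂ : Fin m₂ → Fin n × Fin n) → Set
BiCompTransfer ends₁ ends₂ = ∀ VS ES → BiComp ends₁ VS ES
  → ∃[ VS′ ] ∃[ ES′ ] (BiComp ends₂ VS′ ES′ × retSub ends₂ VS′ ES′ ≡ retSub ends₁ VS ES)

transfers-same-level : ∀ {n m₁ m₂} {ends₁ : Fin m₁ → Fin n × Fin n} {ends₂ : Fin m₂ → Fin n × Fin n}
  → BiCompTransfer ends₁ ends₂ → BiCompTransfer ends₂ ends₁ → SameLevel ends₁ ends₂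
transfers-same-level t₁₂ t₂₁ = transfer t₁₂ t₂₁ , transfer t₂₁ t₁₂
  where
  transfer : ∀ {m m′} {e : Fin m → _} {e′ : Fin m′ → _} → BiCompTransfer e e′ → BiCompTransfer e′ e
    → ∀ {l} → IsLevel e l → IsLevel e′ l
  transfer t t′ (bound , VS , ES , bc , ret≡l) =
    (λ VS′ ES′ bc′ → let (_ , _ , bc₁ , r) = t′ VS′ ES′ bc′ in subst (ℤ._≤ _) r (bound _ _ bc₁)) ,
    (let (VS′ , ES′ , bc₂ , r) = t VS ES bc in VS′ , ES′ , bc₂ , trans r ret≡l)

BlobTransfer : ∀ {n m₁ m₂} (ends₁ : Fin m₁ → Fin n × Fin n) (ends₂ : Fin m₂ → Fin n × Fin n) → Set
BlobTransfer ends₁ ends₂ = ∀ VS ES → Blob ends₁ VS ES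
  → ∃[ VS′ ] ∃[ ES′ ] (Blob ends₂ VS′ ES′ × retSub ends₂ VS′ ES′ ≡ retSub ends₁ VS ES)

-- In a loopless graph a biconnected component is either a blob or a single edge
-- with reticulation number 0; so blobs plus one zero component suffice.
blob-transfer : ∀ {n m₁ m₂} {ends₁ : Fin m₁ → Fin n × Fin n} {ends₂ : Fin m₂ → Fin n × Fin n}
  → Graph.Loopless ends₁ → Graph.ZeroBiComp ends₂ → BlobTransfer ends₁ ends₂ → BiCompTransfer ends₁ ends₂
blob-transfer {ends₁ = ends₁} loopless (V₀ , E₀ , bc₀ , ret₀) bt VS ES bc@(wf , tc , size , max)
  with ∣ ES ∣ ℕP.≟ 1
... | yes one = V₀ , E₀ , bc₀ , trans ret₀ (sym (Graph.single-edge-ret ends₁ loopless bc one))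
... | no ¬one with bt VS ES (wf , tc , ℕP.≤∧≢⇒< size (¬one ∘ sym) , max)
...   | VS′ , ES′ , (wf′ , tc′ , size′ , max′) , r = VS′ , ES′ , (wf′ , tc′ , ℕP.≤-trans (s≤s z≤n) size′ , max′) , r

maximal-TwoConn : ∀ {n m b} {ends : Fin m → Fin n × Fin n} {VS ES} → MaxTwoConn ends b VS ES → Graph.TwoConn ends b VS ES
maximal-TwoConn (wf , tc , size , _) = wf , tc , size

-- Maximal 2-connected subgraphs correspond under maps F and H between subgraphs
-- that preserve 2-connected candidates and are inverse up to inclusion.
_⊆₂_ : ∀ {n m} → Subset n × Subset m → Subset n × Subset m → Set
(VS , ES) ⊆₂ (VS′ , ES′) = VS ⊆ VS′ × ES ⊆ ES′

TwoConn′ : ∀ {n m} (ends : Fin m → Fin n × Fin n) → ℕ → Subset n × Subset m → Set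
TwoConn′ ends b (VS , ES) = Graph.TwoConn ends b VS ES

module MaximalTransfer {n m₁ m₂} (ends₁ : Fin m₁ → Fin n × Fin n) (ends₂ : Fin m₂ → Fin n × Fin n) (b : ℕ)
  (F : Subset n × Subset m₁ → Subset n × Subset m₂)
  (H : Subset n × Subset m₂ → Subset n × Subset m₁)
  (F-TwoConn : ∀ X → TwoConn′ ends₁ b X → TwoConn′ ends₂ b (F X))
  (H-TwoConn : ∀ Y → TwoConn′ ends₂ b Y → TwoConn′ ends₁ b (H Y))
  (F⊆⇒⊆H : ∀ X Y → TwoConn′ ends₁ b X → TwoConn′ ends₂ b Y → F X ⊆₂ Y → X ⊆₂ H Y)
  (H≡⇒⊆F : ∀ X Y → TwoConn′ ends₁ b X → TwoConn′ ends₂ b Y → H Y ≡ X → Y ⊆₂ F X) where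

  maximal : ∀ VS ES → MaxTwoConn ends₁ b VS ES → MaxTwoConn ends₂ b (proj₁ (F (VS , ES))) (proj₂ (F (VS , ES)))
  maximal VS ES (wf , tc , size , max) = proj₁ FX , proj₁ (proj₂ FX) , proj₂ (proj₂ FX) , max₂
    where
    X : Subset n × Subset m₁
    X = VS , ES
    candX : TwoConn′ ends₁ b X
    candX = wf , tc , size
    FX : TwoConn′ ends₂ b (F X)
    FX = F-TwoConn X candX
    -- a candidate Y above F X pulls back to H Y above X, so H Y = X by maximality and Y ⊆ F X
    max₂ : ∀ VS′ ES′ → WellFormed ends₂ VS′ ES′ → TwoConnSub ends₂ VS′ ES′ → proj₁ (F X) ⊆ VS′ → proj₂ (F X) ⊆ ES′
         → VS′ ≡ proj₁ (F X) × ES′ ≡ proj₂ (F X)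
    max₂ VS′ ES′ wf′ tc′ VS⊆ ES⊆ = ⊆-antisym (proj₁ Y⊆FX) VS⊆ , ⊆-antisym (proj₂ Y⊆FX) ES⊆
      where
      Y : Subset n × Subset m₂
      Y = VS′ , ES′
      candY : TwoConn′ ends₂ b Y
      candY = wf′ , tc′ , ℕP.≤-trans (proj₂ (proj₂ FX)) (p⊆q⇒∣p∣≤∣q∣ ES⊆)
      X⊆HY : X ⊆₂ H Y
      X⊆HY = F⊆⇒⊆H X Y candX candY (VS⊆ , ES⊆)
      HY : TwoConn′ ends₁ b (H Y)
      HY = H-TwoConn Y candY
      HY≡X : proj₁ (H Y) ≡ VS × proj₂ (H Y) ≡ ES
      HY≡X = max (proj₁ (H Y)) (proj₂ (H Y)) (proj₁ HY) (proj₁ (proj₂ HY)) (proj₁ X⊆HY) (proj₂ X⊆HY)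
      Y⊆FX : Y ⊆₂ F X
      Y⊆FX = H≡⇒⊆F X Y candX candY (cong₂ _,_ (proj₁ HY≡X) (proj₂ HY≡X))

module _ {A : Set} where
  UEq-sym : {p q : A × A} → UEq p q → UEq q p
  UEq-sym (inj₁ refl) = inj₁ refl
  UEq-sym (inj₂ refl) = inj₂ refl

  UEq-trans : {p q r : A × A} → UEq p q → UEq q r → UEq p r
  UEq-trans (inj₁ refl) q≈r         = q≈r
  UEq-trans (inj₂ refl) (inj₁ refl) = inj₂ refl
  UEq-trans (inj₂ refl) (inj₂ refl) = inj₁ refl

  UEq-map : ∀ {B : Set} (h : A → B) {p q : A × A} → UEq p q → UEq (×-map h h p) (×-map h h q)
  UEq-map h (inj₁ refl) = inj₁ refl
  UEq-map h (inj₂ refl) = inj₂ refl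

  UEq-proj₁ : ∀ {p : A × A} {x y} → UEq p (x , y) → proj₁ p ≡ x ⊎ proj₁ p ≡ y
  UEq-proj₁ (inj₁ refl) = inj₁ refl
  UEq-proj₁ (inj₂ refl) = inj₂ refl

  UEq-proj₂ : ∀ {p : A × A} {x y} → UEq p (x , y) → proj₂ p ≡ x ⊎ proj₂ p ≡ y
  UEq-proj₂ (inj₁ refl) = inj₂ refl
  UEq-proj₂ (inj₂ refl) = inj₁ refl

-- A bijection between the index sets of two families that relates
-- corresponding members by R.  With R relating edges, this is an edge
-- bijection between two graphs.
record EBij {A B : Set} {m₁ m₂ : ℕ} (R : A → B → Set) (e₁ : Fin m₁ → A) (e₂ : Fin m₂ → B) : Set where
  field
    f   : Fin m₁ → Fin m₂
    g   : Fin m₂ → Fin m₁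
    gf  : ∀ i → g (f i) ≡ i
    fg  : ∀ j → f (g j) ≡ j
    rel : ∀ i → R (e₁ i) (e₂ (f i))

ebij-trans : ∀ {A B C : Set} {m₁ m₂ m₃} {R₁ : A → B → Set} {R₂ : B → C → Set} {R₃ : A → C → Set}
  {e₁ : Fin m₁ → A} {e₂ : Fin m₂ → B} {e₃ : Fin m₃ → C}
  → EBij R₁ e₁ e₂ → EBij R₂ e₂ e₃ → (∀ {p q r} → R₁ p q → R₂ q r → R₃ p r) → EBij R₃ e₁ e₃
ebij-trans b₁ b₂ compose = record
  { f   = EBij.f b₂ ∘ EBij.f b₁
  ; g   = EBij.g b₁ ∘ EBij.g b₂
  ; gf  = λ i → trans (cong (EBij.g b₁) (EBij.gf b₂ (EBij.f b₁ i))) (EBij.gf b₁ i)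
  ; fg  = λ j → trans (cong (EBij.f b₂) (EBij.fg b₁ (EBij.g b₂ j))) (EBij.fg b₂ j)
  ; rel = λ i → compose (EBij.rel b₁ i) (EBij.rel b₂ (EBij.f b₁ i)) }

Mapped : ∀ {n} → (Fin n → Fin n) → Fin n × Fin n → Fin n × Fin n → Set
Mapped φ p q = UEq q (×-map φ φ p)

-- An isomorphism between graphs on Fin n
-- consists of an edge bijection along a vertex map φ, together with a map ψ
-- inverse to φ on all non-isolated vertices.  The image of a 2-connected
-- subgraph is 2-connected of the same size, so biconnected components correspond.

module IsoImage {n m₁ m₂} {ends₁ : Fin m₁ → Fin n × Fin n} {ends₂ : Fin m₂ → Fin n × Fin n}
  (φ ψ : Fin n → Fin n) (iso : EBij (Mapped φ) ends₁ ends₂)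
  (ψφ : ∀ e v → Graph.Touches ends₁ e v → ψ (φ v) ≡ v) where

  open EBij iso
  open Graph ends₁ using (Touches; vertex-touched)

  image-V? : (VS : Subset n) → ∀ w → Dec (ψ w ∈ VS × φ (ψ w) ≡ w)
  image-V? VS w = (ψ w ∈? VS) ×-dec (φ (ψ w) ≟ w)
  image-E? : (ES : Subset m₁) → ∀ e′ → Dec (g e′ ∈ ES)
  image-E? ES e′ = g e′ ∈? ES

  FV : Subset n → Subset n
  FV VS = subsetOf (image-V? VS)
  FE : Subset m₁ → Subset m₂
  FE ES = subsetOf (image-E? ES)
  F : Subset n × Subset m₁ → Subset n × Subset m₂
  F (VS , ES) = FV VS , FE ES

  FV⁻ : ∀ {VS w} → w ∈ FV VS → ψ w ∈ VS × φ (ψ w) ≡ w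
  FV⁻ {VS} = subsetOf⁻ (image-V? VS)
  FV⁺ : ∀ {VS w} → ψ w ∈ VS → φ (ψ w) ≡ w → w ∈ FV VS
  FV⁺ {VS} a b = subsetOf⁺ (image-V? VS) (a , b)
  φ∈FV : ∀ {VS v} e → Touches e v → v ∈ VS → φ v ∈ FV VS
  φ∈FV {VS} {v} e t v∈ = FV⁺ (subst (_∈ VS) (sym (ψφ e v t)) v∈) (cong φ (ψφ e v t))
  FE⁻ : ∀ {ES e′} → e′ ∈ FE ES → g e′ ∈ ES
  FE⁻ {ES} = subsetOf⁻ (image-E? ES)
  FE⁺ : ∀ {ES e′} → g e′ ∈ ES → e′ ∈ FE ES
  FE⁺ {ES} = subsetOf⁺ (image-E? ES)
  f∈FE : ∀ {ES e} → e ∈ ES → f e ∈ FE ES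
  f∈FE {ES} {e} e∈ = FE⁺ (subst (_∈ ES) (sym (gf e)) e∈)

  joins-image : ∀ {e u w} → Joins ends₁ e u w → Joins ends₂ (f e) (φ u) (φ w)
  joins-image {e} j = UEq-trans (rel e) (UEq-map φ j)

  walk-image : ∀ {P₁ Q₁ P₂ Q₂ u v}
    → (∀ {x} → P₁ x → ∃[ e ] Touches e x) → (∀ {x} → P₁ x → ∃[ e ] Touches e x → P₂ (φ x))
    → (∀ {e} → Q₁ e → Q₂ (f e))
    → Walk ends₁ P₁ Q₁ u v → Walk ends₂ P₂ Q₂ (φ u) (φ v)
  walk-image touched P⇒ Q⇒ (here pu)          = here (P⇒ pu (touched pu))
  walk-image touched P⇒ Q⇒ (step e pu qe j r) = step (f e) (P⇒ pu (touched pu)) (Q⇒ qe) (joins-image j) (walk-image touched P⇒ Q⇒ r)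

  module _ {VS ES} (cand : Graph.TwoConn ends₁ 1 VS ES) where
    private
      wf : WellFormed ends₁ VS ES
      wf = proj₁ cand
      tc : TwoConnSub ends₁ VS ES
      tc = proj₁ (proj₂ cand)
      touched : ∀ {x} → x ∈ VS → ∃[ e ] Touches e x
      touched x∈ = let (e , _ , t) = vertex-touched ℕP.≤-refl cand x∈ in e , t

    image-wf : WellFormed ends₂ (FV VS) (FE ES)
    image-wf e′ e′∈ = end-in (UEq-proj₁ j) , end-in (UEq-proj₂ j)
      where
      e : Fin m₁
      e = g e′
      j : UEq (ends₂ e′) (×-map φ φ (ends₁ e))
      j = subst (λ k → UEq (ends₂ k) (×-map φ φ (ends₁ e))) (fg e′) (rel e)
      end-in : ∀ {c} → c ≡ φ (proj₁ (ends₁ e)) ⊎ c ≡ φ (proj₂ (ends₁ e)) → c ∈ FV VS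
      end-in (inj₁ refl) = φ∈FV e (inj₁ refl) (proj₁ (wf e (FE⁻ e′∈)))
      end-in (inj₂ refl) = φ∈FV e (inj₂ refl) (proj₂ (wf e (FE⁻ e′∈)))

    image-connected : ConnSub ends₂ (FV VS) (FE ES)
    image-connected u v u∈ v∈ = Graph.walk-subst ends₂ (proj₂ (FV⁻ u∈)) (proj₂ (FV⁻ v∈))
      (walk-image touched (λ x∈ (e , t) → φ∈FV e t x∈) f∈FE
        (proj₁ tc (ψ u) (ψ v) (proj₁ (FV⁻ u∈)) (proj₁ (FV⁻ v∈))))

    -- a walk avoiding ψ z maps to a walk avoiding z
    image-two-connected : TwoConnSub ends₂ (FV VS) (FE ES)
    image-two-connected = image-connected , avoid
      where
      avoid : ∀ z → z ∈ FV VS → ∀ u v → u ∈ FV VS → v ∈ FV VS → u ≢ z → v ≢ z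
        → Walk ends₂ (λ w → w ∈ FV VS × w ≢ z) (_∈ FE ES) u v
      avoid z z∈ u v u∈ v∈ u≢z v≢z = Graph.walk-subst ends₂ u-back v-back (walk-image (touched ∘ proj₁) P⇒ f∈FE avoiding)
        where
        u-back : φ (ψ u) ≡ u
        u-back = proj₂ (FV⁻ u∈)
        v-back : φ (ψ v) ≡ v
        v-back = proj₂ (FV⁻ v∈)
        z-back : φ (ψ z) ≡ z
        z-back = proj₂ (FV⁻ z∈)
        avoiding : Walk ends₁ (λ w → w ∈ VS × w ≢ ψ z) (_∈ ES) (ψ u) (ψ v)
        avoiding = proj₂ tc (ψ z) (proj₁ (FV⁻ z∈)) (ψ u) (ψ v) (proj₁ (FV⁻ u∈)) (proj₁ (FV⁻ v∈))
                     (λ e → u≢z (trans (sym u-back) (trans (cong φ e) z-back)))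
                     (λ e → v≢z (trans (sym v-back) (trans (cong φ e) z-back)))
        P⇒ : ∀ {x} → x ∈ VS × x ≢ ψ z → ∃[ e ] Touches e x → φ x ∈ FV VS × φ x ≢ z
        P⇒ (x∈ , x≢) (e , t) = φ∈FV e t x∈ , λ eq → x≢ (trans (sym (ψφ e _ t)) (cong ψ eq))

    ∣FE∣ : ∣ FE ES ∣ ≡ ∣ ES ∣
    ∣FE∣ = sym (bijection-∣≡∣ ES (FE ES) f g (λ e e∈ → f∈FE e∈ , gf e) (λ e′ e′∈ → FE⁻ e′∈ , fg e′))

    ∣FV∣ : ∣ FV VS ∣ ≡ ∣ VS ∣
    ∣FV∣ = sym (bijection-∣≡∣ VS (FV VS) φ ψ
      (λ v v∈ → let (e , t) = touched v∈ in φ∈FV e t v∈ , ψφ e v t)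
      (λ w w∈ → FV⁻ w∈))

    image-TwoConn : TwoConn′ ends₂ 1 (F (VS , ES))
    image-TwoConn = image-wf , image-two-connected , subst (1 ≤_) (sym ∣FE∣) (proj₂ (proj₂ cand))

    image-ret : retSub ends₂ (FV VS) (FE ES) ≡ retSub ends₁ VS ES
    image-ret = cong₂ (λ a b → (ℤ.+ a ℤ.- ℤ.+ b) ℤ.+ ℤ.+ 1) ∣FE∣ ∣FV∣

iso-inverse : ∀ {n m₁ m₂} {ends₁ : Fin m₁ → Fin n × Fin n} {ends₂ : Fin m₂ → Fin n × Fin n}
  (φ ψ : Fin n → Fin n) → EBij (Mapped φ) ends₁ ends₂
  → (∀ e v → Graph.Touches ends₁ e v → ψ (φ v) ≡ v) → EBij (Mapped ψ) ends₂ ends₁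
iso-inverse {ends₁ = ends₁} {ends₂} φ ψ iso ψφ = record
  { f = g ; g = f ; gf = fg ; fg = gf ; rel = back }
  where
  open EBij iso
  back : ∀ e′ → UEq (ends₁ (g e′)) (×-map ψ ψ (ends₂ e′))
  back e′ = UEq-sym (subst (λ k → UEq (×-map ψ ψ (ends₂ k)) (ends₁ e)) (fg e′) ψ-image)
    where
    e : Fin _
    e = g e′
    ψ-image : UEq (×-map ψ ψ (ends₂ (f e))) (ends₁ e)
    ψ-image = subst (UEq (×-map ψ ψ (ends₂ (f e)))) (cong₂ _,_ (ψφ e _ (inj₁ refl)) (ψφ e _ (inj₂ refl)))
                (UEq-map ψ (rel e))

module IsoTransfer {n m₁ m₂} {ends₁ : Fin m₁ → Fin n × Fin n} {ends₂ : Fin m₂ → Fin n × Fin n}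
  (φ ψ : Fin n → Fin n) (iso : EBij (Mapped φ) ends₁ ends₂)
  (ψφ : ∀ e v → Graph.Touches ends₁ e v → ψ (φ v) ≡ v) (φψ : ∀ e v → Graph.Touches ends₂ e v → φ (ψ v) ≡ v) where

  module A = IsoImage φ ψ iso ψφ
  module B = IsoImage ψ φ (iso-inverse φ ψ iso ψφ) φψ

  A⊆⇒⊆B : ∀ X Y → TwoConn′ ends₁ 1 X → TwoConn′ ends₂ 1 Y → A.F X ⊆₂ Y → X ⊆₂ B.F Y
  A⊆⇒⊆B (VS , ES) _ candX _ (VS⊆ , ES⊆) =
    (λ {v} v∈ → let (e , _ , t) = Graph.vertex-touched ends₁ ℕP.≤-refl candX v∈ in
       B.FV⁺ (VS⊆ (A.φ∈FV e t v∈)) (ψφ e v t)) ,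
    (λ e∈ → B.FE⁺ (ES⊆ (A.f∈FE e∈)))

  B≡⇒⊆A : ∀ X Y → TwoConn′ ends₁ 1 X → TwoConn′ ends₂ 1 Y → B.F Y ≡ X → Y ⊆₂ A.F X
  B≡⇒⊆A _ (VS′ , ES′) _ candY refl =
    (λ {w} w∈ → let (e , _ , t) = Graph.vertex-touched ends₂ ℕP.≤-refl candY w∈ in
       A.FV⁺ (B.φ∈FV e t w∈) (φψ e w t)) ,
    (λ e∈ → A.FE⁺ (B.f∈FE e∈))

  open MaximalTransfer ends₁ ends₂ 1 A.F B.F (λ _ → A.image-TwoConn) (λ _ → B.image-TwoConn) A⊆⇒⊆B B≡⇒⊆A

  transfer : BiCompTransfer ends₁ ends₂
  transfer VS ES bc = _ , _ , maximal VS ES bc , A.image-ret (proj₁ bc , proj₁ (proj₂ bc) , proj₁ (proj₂ (proj₂ bc)))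

iso-same-level : ∀ {n m₁ m₂} {ends₁ : Fin m₁ → Fin n × Fin n} {ends₂ : Fin m₂ → Fin n × Fin n}
  (φ ψ : Fin n → Fin n) (iso : EBij (Mapped φ) ends₁ ends₂)
  → (∀ e v → Graph.Touches ends₁ e v → ψ (φ v) ≡ v) → (∀ e v → Graph.Touches ends₂ e v → φ (ψ v) ≡ v)
  → SameLevel ends₁ ends₂
iso-same-level φ ψ iso ψφ φψ = transfers-same-level (IsoTransfer.transfer φ ψ iso ψφ φψ)
  (IsoTransfer.transfer ψ φ (iso-inverse φ ψ iso ψφ) φψ ψφ)

relabel-same-level : ∀ {n m₁ m₂} {ends₁ : Fin m₁ → Fin n × Fin n} {ends₂ : Fin m₂ → Fin n × Fin n}
  → EBij (Mapped id) ends₁ ends₂ → SameLevel ends₁ ends₂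
relabel-same-level iso = iso-same-level id id iso (λ _ _ _ → refl) (λ _ _ _ → refl)

-- Pendant edges lie in no blob, so adding one does not change the level.

module Blobs {n m : ℕ} (ends : Fin m → Fin n × Fin n) where
  open Graph ends

  not-all-towards : ∀ {b VS ES p q t} → TwoConn b VS ES → p ∈ VS → t ∈ VS → t ≢ p → t ≢ q → p ≢ q
    → (∀ e w → e ∈ ES → Joins ends e p w → w ≡ q) → ⊥
  not-all-towards {VS = VS} {q = q} (_ , (cs , tc) , _) p∈ t∈ t≢p t≢q p≢q towards with q ∈? VS
  ... | yes q∈ = stuck-at-start q (tc q q∈ _ _ p∈ t∈ p≢q t≢q) (t≢p ∘ sym) towards (λ w∈ → proj₂ w∈ refl)
  ... | no  q∉ = stuck-at-start q (cs _ _ p∈ t∈) (t≢p ∘ sym) towards q∉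

  third-vertex : Loopless → ∀ {VS ES p q e} → WellFormed ends VS ES → e ∈ ES → ¬ Touches e p
    → ∃[ t ] (t ∈ VS × t ≢ p × t ≢ q)
  third-vertex loopless {q = q} {e} wf e∈ ¬at-p with proj₁ (ends e) ≟ q
  ... | no  ≢q = proj₁ (ends e) , proj₁ (wf e e∈) , (¬at-p ∘ inj₁) , ≢q
  ... | yes ≡q = proj₂ (ends e) , proj₂ (wf e e∈) , (¬at-p ∘ inj₂) , (λ ≡q′ → loopless e (trans ≡q (sym ≡q′)))

  pendant∉ : Loopless → ∀ {p e₀ q} → Pendant p e₀ q → ∀ {VS ES} → TwoConn 2 VS ES → p ∉ VS
  pendant∉ loopless {p} {e₀} {q} (j₀ , p≢q , only-e₀) cand@(wf , _ , size) p∈ with member-≢ _ size e₀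
  ... | e , e∈ , e≢e₀ with third-vertex loopless {q = q} wf e∈ (e≢e₀ ∘ only-e₀ e)
  ... | t , t∈ , t≢p , t≢q = not-all-towards cand p∈ t∈ t≢p t≢q p≢q towards
    where
    towards : ∀ e w → e ∈ _ → Joins ends e p w → w ≡ q
    towards e w _ j with only-e₀ e (joins-touches₁ j)
    ... | refl = joins-other j₀ j refl

module AddPendant {n m} (ends₁ : Fin m → Fin n × Fin n) (v w : Fin n) where
  ends₂ : Fin (suc m) → Fin n × Fin n
  ends₂ zero    = v , w
  ends₂ (suc e) = ends₁ e

  module _ (v≢w : v ≢ w) (untouched : ∀ e → ¬ Graph.Touches ends₁ e v) (loopless₁ : Graph.Loopless ends₁) where
    loopless₂ : Graph.Loopless ends₂
    loopless₂ zero    = v≢w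
    loopless₂ (suc e) = loopless₁ e

    pendant : Graph.Pendant ends₂ v zero w
    pendant = inj₁ refl , v≢w , only-zero
      where
      only-zero : ∀ e → Graph.Touches ends₂ e v → e ≡ zero
      only-zero zero    _ = refl
      only-zero (suc e) t = ⊥-elim (untouched e t)

    zero∉ : ∀ Y → TwoConn′ ends₂ 2 Y → zero ∉ proj₂ Y
    zero∉ _ cand zero∈ = Blobs.pendant∉ ends₂ loopless₂ pendant cand (proj₁ (proj₁ cand zero zero∈))

    F : Subset n × Subset m → Subset n × Subset (suc m)
    F (VS , ES) = VS , outside ∷ ES
    H : Subset n × Subset (suc m) → Subset n × Subset m
    H (VS , ES) = VS , tail ES

    lift-walk : ∀ {P ES u v} → Walk ends₁ P (_∈ ES) u v → Walk ends₂ P (_∈ outside ∷ ES) u v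
    lift-walk (here pu)          = here pu
    lift-walk (step e pu e∈ j r) = step (suc e) pu (there e∈) j (lift-walk r)

    lower-walk : ∀ {P b ES u v} → zero ∉ b ∷ ES → Walk ends₂ P (_∈ b ∷ ES) u v → Walk ends₁ P (_∈ ES) u v
    lower-walk z∉ (here pu)                    = here pu
    lower-walk z∉ (step zero    _  z∈ _ _)     = ⊥-elim (z∉ z∈)
    lower-walk z∉ (step (suc e) pu (there e∈) j r) = step e pu e∈ j (lower-walk z∉ r)

    F-TwoConn : ∀ X → TwoConn′ ends₁ 2 X → TwoConn′ ends₂ 2 (F X)
    F-TwoConn (VS , ES) (wf , (cs , tc) , size) =
      wf′ , ((λ u v u∈ v∈ → lift-walk (cs u v u∈ v∈)) ,
             (λ z z∈ u v u∈ v∈ u≢z v≢z → lift-walk (tc z z∈ u v u∈ v∈ u≢z v≢z))) , size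
      where
      wf′ : WellFormed ends₂ VS (outside ∷ ES)
      wf′ (suc e) (there e∈) = wf e e∈

    ∣H∣ : ∀ Y → TwoConn′ ends₂ 2 Y → ∣ proj₂ (H Y) ∣ ≡ ∣ proj₂ Y ∣
    ∣H∣ (VS , outside ∷ ES) cand = refl
    ∣H∣ (VS , inside ∷ ES)  cand = ⊥-elim (zero∉ _ cand here)

    H-TwoConn : ∀ Y → TwoConn′ ends₂ 2 Y → TwoConn′ ends₁ 2 (H Y)
    H-TwoConn (VS , b ∷ ES) cand@(wf , (cs , tc) , size) =
      (λ e e∈ → wf (suc e) (there e∈)) ,
      ((λ u v u∈ v∈ → lower-walk z∉ (cs u v u∈ v∈)) ,
       (λ z z∈ u v u∈ v∈ u≢z v≢z → lower-walk z∉ (tc z z∈ u v u∈ v∈ u≢z v≢z))) ,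
      subst (2 ≤_) (sym (∣H∣ (VS , b ∷ ES) cand)) size
      where
      z∉ : zero ∉ b ∷ ES
      z∉ = zero∉ (VS , b ∷ ES) cand

    F⊆⇒⊆H : ∀ X Y → TwoConn′ ends₁ 2 X → TwoConn′ ends₂ 2 Y → F X ⊆₂ Y → X ⊆₂ H Y
    F⊆⇒⊆H _ (_ , b ∷ _) _ _ (VS⊆ , ES⊆) = VS⊆ , λ e∈ → drop-there (ES⊆ (there e∈))

    H≡⇒⊆F : ∀ X Y → TwoConn′ ends₁ 2 X → TwoConn′ ends₂ 2 Y → H Y ≡ X → Y ⊆₂ F X
    H≡⇒⊆F _ (_ , outside ∷ _) _ _    refl = id , id
    H≡⇒⊆F _ (_ , inside ∷ _)  _ cand refl = ⊥-elim (zero∉ _ cand here)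

    H⊆⇒⊆F : ∀ Y X → TwoConn′ ends₂ 2 Y → TwoConn′ ends₁ 2 X → H Y ⊆₂ X → Y ⊆₂ F X
    H⊆⇒⊆F (_ , b ∷ _) _ cand _ (VS⊆ , ES⊆) = VS⊆ , ES′⊆
      where
      ES′⊆ : ∀ {e} → e ∈ b ∷ _ → e ∈ outside ∷ _
      ES′⊆ {zero}  z∈         = ⊥-elim (zero∉ _ cand z∈)
      ES′⊆ {suc e} (there e∈) = there (ES⊆ e∈)

    F≡⇒⊆H : ∀ Y X → TwoConn′ ends₂ 2 Y → TwoConn′ ends₁ 2 X → F X ≡ Y → X ⊆₂ H Y
    F≡⇒⊆H _ _ _ _ refl = id , id

    module Up   = MaximalTransfer ends₁ ends₂ 2 F H F-TwoConn H-TwoConn F⊆⇒⊆H H≡⇒⊆F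
    module Down = MaximalTransfer ends₂ ends₁ 2 H F H-TwoConn F-TwoConn H⊆⇒⊆F F≡⇒⊆H

    blobs-up : BlobTransfer ends₁ ends₂
    blobs-up VS ES blob = _ , _ , Up.maximal VS ES blob , refl

    blobs-down : BlobTransfer ends₂ ends₁
    blobs-down VS ES blob = _ , _ , Down.maximal VS ES blob ,
      cong (λ k → (ℤ.+ k ℤ.- ℤ.+ ∣ VS ∣) ℤ.+ ℤ.+ 1) (∣H∣ (VS , ES) (maximal-TwoConn blob))

    -- ends₂ always has the zero component formed by the new edge; ends₁ needs one
    pendant-same-level : Graph.ZeroBiComp ends₁ → SameLevel ends₁ ends₂
    pendant-same-level zero₁ =
      transfers-same-level (blob-transfer loopless₁ (Graph.pendant-bicomp ends₂ loopless₂ pendant) blobs-up)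
                 (blob-transfer loopless₂ zero₁ blobs-down)

-- Blobs correspond: a candidate of  subdivided  contains both halves of the
-- path or neither (u has degree 2), and collapsing u gives a candidate of
-- direct; conversely a candidate containing {a, b} is re-expanded through u.
-- The edge count and the vertex count change together, so ret is preserved.

outside≢inside : outside ≢ inside
outside≢inside ()

-- one more edge and one more vertex: same reticulation number
ret-shift : ∀ a b → (ℤ.+ suc a ℤ.- ℤ.+ suc b) ℤ.+ ℤ.+ 1 ≡ (ℤ.+ a ℤ.- ℤ.+ b) ℤ.+ ℤ.+ 1
ret-shift a b = cong (ℤ._+ ℤ.+ 1) (trans (ℤP.m-n≡m⊖n (suc a) (suc b)) (trans (ℤP.[1+m]⊖[1+n]≡m⊖n a b) (sym (ℤP.m-n≡m⊖n a b))))

walk-bind : ∀ {n m₁ m₂} {ends₁ : Fin m₁ → Fin n × Fin n} {ends₂ : Fin m₂ → Fin n × Fin n}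
  (ρ : Fin n → Fin n) {P₁ P₂ Q₁ Q₂}
  → (∀ {x} → P₁ x → P₂ (ρ x))
  → (∀ e {x y} → P₁ x → Q₁ e → Joins ends₁ e x y → P₁ y → Walk ends₂ P₂ Q₂ (ρ x) (ρ y))
  → ∀ {u v} → Walk ends₁ P₁ Q₁ u v → Walk ends₂ P₂ Q₂ (ρ u) (ρ v)
walk-bind ρ P⇒ edge⇒ (here pu) = here (P⇒ pu)
walk-bind {ends₂ = ends₂} ρ P⇒ edge⇒ (step e pu qe j r) =
  Graph._++w_ ends₂ (edge⇒ e pu qe j (Graph.walk-head _ r)) (walk-bind ρ P⇒ edge⇒ r)

module Subdivision {n r} (rest : Fin r → Fin n × Fin n) (a u b : Fin n) where
  direct : Fin (suc r) → Fin n × Fin n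
  direct zero = a , b
  direct (suc i) = rest i
  subdivided : Fin (suc (suc r)) → Fin n × Fin n
  subdivided zero = a , u
  subdivided (suc zero) = u , b
  subdivided (suc (suc i)) = rest i

  module Conditions (u≢a : u ≢ a) (u≢b : u ≢ b) (a≢b : a ≢ b) (u∉rest : ∀ i → ¬ Graph.Touches rest i u) (rest-loopless : Graph.Loopless rest) where
    direct-loopless : Graph.Loopless direct
    direct-loopless zero = a≢b
    direct-loopless (suc i) = rest-loopless i
    subdivided-loopless : Graph.Loopless subdivided
    subdivided-loopless zero = u≢a ∘ sym
    subdivided-loopless (suc zero) = u≢b
    subdivided-loopless (suc (suc i)) = rest-loopless i

    u-untouched : ∀ e → ¬ Graph.Touches direct e u
    u-untouched zero (inj₁ x) = u≢a (sym x)
    u-untouched zero (inj₂ y) = u≢b (sym y)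
    u-untouched (suc i) t = u∉rest i t

    rest-avoids-u : ∀ {i x y} → Joins subdivided (suc (suc i)) x y → (x ≢ u) × (y ≢ u)
    rest-avoids-u {i} j = (λ e → u∉rest i (subst (Graph.Touches rest i) e (Graph.joins-touches₁ subdivided j))) ,
                   (λ e → u∉rest i (subst (Graph.Touches rest i) e (Graph.joins-touches₂ subdivided j)))

    -- In a candidate blob of  subdivided , u is present iff both halves
    -- a – u and u – b are: u has no other edges, and a blob vertex has two.
    u∈-by-first : ∀ {VS c1 c2 ES} → Graph.TwoConn subdivided 2 VS (c1 ∷ c2 ∷ ES) → c1 ≡ inside → u ∈ VS
    u∈-by-first cand refl = proj₂ (proj₁ cand zero here)
    u∈-by-second : ∀ {VS c1 c2 ES} → Graph.TwoConn subdivided 2 VS (c1 ∷ c2 ∷ ES) → c2 ≡ inside → u ∈ VS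
    u∈-by-second cand refl = proj₁ (proj₁ cand (suc zero) (there here))

    first-by-u∈ : ∀ {VS c1 c2 ES} → Graph.TwoConn subdivided 2 VS (c1 ∷ c2 ∷ ES) → u ∈ VS → c1 ≡ inside
    first-by-u∈ {c1 = inside} cand um = refl
    first-by-u∈ {VS} {outside} {c2} {ES} cand um with member-≢ (outside ∷ c2 ∷ ES) (proj₂ (proj₂ cand)) (suc zero)
    ... | zero , () , _
    ... | suc zero , _ , ne = ⊥-elim (ne refl)
    ... | suc (suc i) , im , _ with Blobs.third-vertex subdivided subdivided-loopless {p = u} {q = b} (proj₁ cand) im (u∉rest i)
    ...   | t , tm , tu , tb = ⊥-elim (Blobs.not-all-towards subdivided cand um tm tu tb u≢b h)
      where
      h : ∀ e w → e ∈ outside ∷ c2 ∷ ES → Joins subdivided e u w → w ≡ b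
      h zero w () j
      h (suc zero) w em j = Graph.joins-other subdivided {suc zero} (Graph.joins-own subdivided (suc zero)) j refl
      h (suc (suc i)) w em j = ⊥-elim (proj₁ (rest-avoids-u j) refl)

    second-by-u∈ : ∀ {VS c1 c2 ES} → Graph.TwoConn subdivided 2 VS (c1 ∷ c2 ∷ ES) → u ∈ VS → c2 ≡ inside
    second-by-u∈ {c2 = inside} cand um = refl
    second-by-u∈ {VS} {c1} {outside} {ES} cand um with member-≢ (c1 ∷ outside ∷ ES) (proj₂ (proj₂ cand)) zero
    ... | zero , _ , ne = ⊥-elim (ne refl)
    ... | suc zero , there () , _
    ... | suc (suc i) , im , _ with Blobs.third-vertex subdivided subdivided-loopless {p = u} {q = a} (proj₁ cand) im (u∉rest i)
    ...   | t , tm , tu , ta = ⊥-elim (Blobs.not-all-towards subdivided cand um tm tu ta u≢a h)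
      where
      h : ∀ e w → e ∈ c1 ∷ outside ∷ ES → Joins subdivided e u w → w ≡ a
      h zero w em j = Graph.joins-other subdivided {zero} (Graph.joins-sym subdivided {zero} (Graph.joins-own subdivided zero)) j refl
      h (suc zero) w (there ()) j
      h (suc (suc i)) w em j = ⊥-elim (proj₁ (rest-avoids-u j) refl)

    halves-agree : ∀ {VS c1 c2 ES} → Graph.TwoConn subdivided 2 VS (c1 ∷ c2 ∷ ES) → c1 ≡ c2
    halves-agree {c1 = inside} {inside} cand = refl
    halves-agree {c1 = outside} {outside} cand = refl
    halves-agree {c1 = inside} {outside} cand = ⊥-elim (outside≢inside (second-by-u∈ cand (u∈-by-first cand refl)))
    halves-agree {c1 = outside} {inside} cand = ⊥-elim (outside≢inside (first-by-u∈ cand (u∈-by-second cand refl)))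

    -- a candidate containing the path a – u – b has a further edge (a – b needs a
    -- second route avoiding u)
    rest-edge : ∀ {VS c2 ES} → Graph.TwoConn subdivided 2 VS (inside ∷ c2 ∷ ES) → ∃[ i ] i ∈ ES
    rest-edge {VS} {c2} {ES} cand with any? (λ i → i ∈? ES)
    ... | yes p = p
    ... | no np = ⊥-elim (Graph.stuck-at-start subdivided u detour a≢b h (λ p → proj₂ p refl))
      where
      um : u ∈ VS
      um = u∈-by-first cand refl
      am : a ∈ VS
      am = proj₁ (proj₁ cand zero here)
      bm : b ∈ VS
      bm = proj₂ (proj₁ cand (suc zero) (subst (λ k → suc zero ∈ inside ∷ k ∷ ES) (sym (second-by-u∈ cand um)) (there here)))
      detour : Walk subdivided (λ w → w ∈ VS × w ≢ u) (_∈ inside ∷ c2 ∷ ES) a b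
      detour = proj₂ (proj₁ (proj₂ cand)) u um a b am bm (u≢a ∘ sym) (u≢b ∘ sym)
      h : ∀ e x → e ∈ inside ∷ c2 ∷ ES → Joins subdivided e a x → x ≡ u
      h zero x em j = Graph.joins-other subdivided {zero} (Graph.joins-own subdivided zero) j refl
      h (suc zero) x em j with Graph.joins-touches₁ subdivided {suc zero} j
      ... | inj₁ e = ⊥-elim (u≢a e)
      ... | inj₂ e = ⊥-elim (a≢b (sym e))
      h (suc (suc i)) x (there (there im)) j = ⊥-elim (np (i , im))

    first∈ : ∀ {c1 c2 : Bool} {k} {ES : Subset k} → zero ∈ c1 ∷ c2 ∷ ES → c1 ≡ inside
    first∈ here = refl
    second∈ : ∀ {c1 c2 : Bool} {k} {ES : Subset k} → suc zero ∈ c1 ∷ c2 ∷ ES → c2 ≡ inside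
    second∈ (there here) = refl

    -- Down: collapse u onto c ∈ {a, b}.  A walk of  subdivided  maps to a walk
    -- of  direct , each half-edge becoming the edge {a, b} or a trivial walk.
    squash : Fin n → Fin n → Fin n
    squash c x with x ≟ u
    ... | yes _ = c
    ... | no _ = x

    squash-id : ∀ {c x} → x ≢ u → squash c x ≡ x
    squash-id {c} {x} nx with x ≟ u
    ... | yes e = ⊥-elim (nx e)
    ... | no _ = refl

    squash-u : ∀ {c} → squash c u ≡ c
    squash-u with u ≟ u
    ... | yes _ = refl
    ... | no nu = ⊥-elim (nu refl)

    module _ {VS c1 c2 ES} (cand : Graph.TwoConn subdivided 2 VS (c1 ∷ c2 ∷ ES)) (Z : Fin n → Set) (c : Fin n)
             (cab : c ≡ a ⊎ c ≡ b) (zc : Z c) where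
      private
        VS₁ : Subset n
        VS₁ = VS [ u ]≔ outside
        Above : Fin n → Set
        Above x = x ∈ VS × Z x
        Below : Fin n → Set
        Below x = x ∈ VS₁ × Z x

      c∈ : u ∈ VS → c ∈ VS
      c∈ um = [ (λ e → subst (_∈ VS) (sym e) (proj₁ (proj₁ cand zero (subst (λ k → zero ∈ k ∷ c2 ∷ ES) (sym (first-by-u∈ cand um)) here)))) ,
                (λ e → subst (_∈ VS) (sym e) (proj₂ (proj₁ cand (suc zero) (subst (λ k → suc zero ∈ c1 ∷ k ∷ ES) (sym (second-by-u∈ cand um)) (there here))))) ]′ cab

      c≢u : c ≢ u
      c≢u = [ (λ e x → u≢a (trans (sym x) e)) , (λ e x → u≢b (trans (sym x) e)) ]′ cab

      lower-vertex : ∀ {x} → Above x → Below (squash c x)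
      lower-vertex {x} (xm , zx) with x ≟ u
      ... | yes refl = ∈-remove⁺ (c∈ xm) c≢u , zc
      ... | no nx = ∈-remove⁺ xm nx , zx

      ab-walk : c1 ≡ inside → Below a → Below b → Walk direct Below (_∈ c1 ∷ ES) a b
      ab-walk refl pa pb = step zero pa here (Graph.joins-own direct zero) (here pb)

      WalkBelow : Fin n → Fin n → Set
      WalkBelow = Walk direct Below (_∈ c1 ∷ ES)

      a⇝c : c1 ≡ inside → Below a → Below c → WalkBelow a c
      a⇝c ci pa pc = [ (λ e → subst (WalkBelow a) (sym e) (here pa)) ,
                       (λ e → subst (WalkBelow a) (sym e) (ab-walk ci pa (subst Below e pc))) ]′ cab
      c⇝b : c1 ≡ inside → Below c → Below b → WalkBelow c b
      c⇝b ci pc pb = [ (λ e → subst (λ k → WalkBelow k b) (sym e) (ab-walk ci (subst Below e pc) pb)) ,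
                       (λ e → subst (λ k → WalkBelow k b) (sym e) (here pb)) ]′ cab

      first-half : zero ∈ c1 ∷ c2 ∷ ES → Below (squash c a) → Below (squash c u) → WalkBelow (squash c a) (squash c u)
      first-half em p q rewrite squash-id {c} (u≢a ∘ sym) | squash-u {c} = a⇝c (first∈ em) p q
      second-half : suc zero ∈ c1 ∷ c2 ∷ ES → Below (squash c u) → Below (squash c b) → WalkBelow (squash c u) (squash c b)
      second-half em p q rewrite squash-id {c} (u≢b ∘ sym) | squash-u {c} = c⇝b (first-by-u∈ cand (u∈-by-second cand (second∈ em))) p q

      lower-edge : ∀ e {x y} → Above x → e ∈ c1 ∷ c2 ∷ ES → Joins subdivided e x y → Above y → WalkBelow (squash c x) (squash c y)
      lower-edge (suc (suc i)) {x} {y} px (there (there im)) j py =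
        Graph.walk-subst direct (sym (squash-id (proj₁ (rest-avoids-u j)))) (sym (squash-id (proj₂ (rest-avoids-u j))))
          (step (suc i) (keep-vertex px (proj₁ (rest-avoids-u j))) (there im) j (here (keep-vertex py (proj₂ (rest-avoids-u j)))))
        where
        keep-vertex : ∀ {x} → Above x → x ≢ u → Below x
        keep-vertex (xm , zx) nx = ∈-remove⁺ xm nx , zx
      lower-edge zero {x} {y} px em j py with Graph.joins-ends subdivided {zero} j
      ... | inj₁ (refl , refl) = first-half em (lower-vertex px) (lower-vertex py)
      ... | inj₂ (refl , refl) = Graph.walk-reverse direct (first-half em (lower-vertex py) (lower-vertex px))
      lower-edge (suc zero) {x} {y} px em j py with Graph.joins-ends subdivided {suc zero} j
      ... | inj₁ (refl , refl) = second-half em (lower-vertex px) (lower-vertex py)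
      ... | inj₂ (refl , refl) = Graph.walk-reverse direct (second-half em (lower-vertex py) (lower-vertex px))

      walk-down : ∀ {x y} → Walk subdivided Above (_∈ c1 ∷ c2 ∷ ES) x y → WalkBelow (squash c x) (squash c y)
      walk-down = walk-bind (squash c) lower-vertex lower-edge

    -- H removes u and the second half-edge (the first one becomes {a, b})
    H : Subset n × Subset (suc (suc r)) → Subset n × Subset (suc r)
    H (VS , c1 ∷ c2 ∷ ES) = VS [ u ]≔ outside , c1 ∷ ES

    size-down : ∀ {VS c1 c2 ES} → Graph.TwoConn subdivided 2 VS (c1 ∷ c2 ∷ ES) → 2 ≤ ∣ c1 ∷ ES ∣
    size-down {c1 = inside} {c2} {ES} cand with rest-edge cand
    ... | i , im = s≤s (subst (1 ≤_) (∣remove∣ im) (s≤s z≤n))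
    size-down {c1 = outside} {outside} cand = proj₂ (proj₂ cand)
    size-down {c1 = outside} {inside} cand = ⊥-elim (outside≢inside (halves-agree cand))

    H-TwoConn : ∀ Y → TwoConn′ subdivided 2 Y → TwoConn′ direct 2 (H Y)
    H-TwoConn (VS , c1 ∷ c2 ∷ ES) cand = wf₁ , (connected₁ , two-connected₁) , size-down cand
      where
      wf₁ : WellFormed direct (VS [ u ]≔ outside) (c1 ∷ ES)
      wf₁ zero here = ∈-remove⁺ (proj₁ (proj₁ cand zero here)) (u≢a ∘ sym) ,
                      ∈-remove⁺ (proj₂ (proj₁ cand (suc zero) (subst (λ k → suc zero ∈ inside ∷ k ∷ ES) (sym (second-by-u∈ cand (u∈-by-first cand refl))) (there here)))) (u≢b ∘ sym)
      wf₁ (suc i) (there im) = ∈-remove⁺ (proj₁ (proj₁ cand (suc (suc i)) (there (there im)))) (λ e → u∉rest i (inj₁ e)) ,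
                               ∈-remove⁺ (proj₂ (proj₁ cand (suc (suc i)) (there (there im)))) (λ e → u∉rest i (inj₂ e))
      connected₁ : ConnSub direct (VS [ u ]≔ outside) (c1 ∷ ES)
      connected₁ u1 v1 mu mv =
        let (m1 , n1) = ∈-remove⁻ mu ; (m2 , n2) = ∈-remove⁻ mv
            w2 = Graph.walk-mono subdivided (λ x → x , tt) id (proj₁ (proj₁ (proj₂ cand)) u1 v1 m1 m2)
        in Graph.walk-mono direct proj₁ id (Graph.walk-subst direct (squash-id n1) (squash-id n2) (walk-down cand (λ _ → ⊤) a (inj₁ refl) tt w2))
      two-connected₁ : ∀ z → z ∈ VS [ u ]≔ outside → ∀ u1 v1 → u1 ∈ VS [ u ]≔ outside → v1 ∈ VS [ u ]≔ outside → u1 ≢ z → v1 ≢ z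
          → Walk direct (λ w → w ∈ VS [ u ]≔ outside × w ≢ z) (_∈ c1 ∷ ES) u1 v1
      two-connected₁ z mz u1 v1 mu mv nu nv with a ≟ z
      ... | yes refl =
        let (zm , zu) = ∈-remove⁻ mz ; (m1 , n1) = ∈-remove⁻ mu ; (m2 , n2) = ∈-remove⁻ mv
        in Graph.walk-subst direct (squash-id n1) (squash-id n2) (walk-down cand (_≢ a) b (inj₂ refl) (a≢b ∘ sym) (proj₂ (proj₁ (proj₂ cand)) a zm u1 v1 m1 m2 nu nv))
      ... | no na =
        let (zm , zu) = ∈-remove⁻ mz ; (m1 , n1) = ∈-remove⁻ mu ; (m2 , n2) = ∈-remove⁻ mv
        in Graph.walk-subst direct (squash-id n1) (squash-id n2) (walk-down cand (_≢ z) a (inj₁ refl) na (proj₂ (proj₁ (proj₂ cand)) z zm u1 v1 m1 m2 nu nv))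

    F : Subset n × Subset (suc r) → Subset n × Subset (suc (suc r))
    F (VS , inside ∷ ES) = VS [ u ]≔ inside , inside ∷ inside ∷ ES
    F (VS , outside ∷ ES) = VS , outside ∷ outside ∷ ES

    u∉direct : ∀ {VS ES} → Graph.TwoConn direct 2 VS ES → u ∉ VS
    u∉direct {VS} {ES} cand um with Graph.vertex-touched direct {2} {VS} {ES} (s≤s z≤n) cand um
    ... | e , _ , t = u-untouched e t

    walk-up-outside : ∀ {P ES x y} → Walk direct P (_∈ outside ∷ ES) x y → Walk subdivided P (_∈ outside ∷ outside ∷ ES) x y
    walk-up-outside (here x) = here x
    walk-up-outside (step (suc i) a (there m) c r) = step (suc (suc i)) a (there (there m)) c (walk-up-outside r)

    NotAB : ∀ {k} → Subset (suc k) → Fin (suc k) → Set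
    NotAB ES e = e ∈ ES × e ≢ zero

    walk-up-avoiding : ∀ {Below Above ES x y} → (∀ {x} → Below x → Above x) → Walk direct Below (NotAB ES) x y → Walk subdivided Above (_∈ inside ∷ inside ∷ tail ES) x y
    walk-up-avoiding P⇒ (here x) = here (P⇒ x)
    walk-up-avoiding P⇒ (step zero a (m , nz) c r) = ⊥-elim (nz refl)
    walk-up-avoiding {ES = b ∷ ES} P⇒ (step (suc i) a (there m , nz) c r) = step (suc (suc i)) (P⇒ a) (there (there m)) c (walk-up-avoiding P⇒ r)

    avoid-direct-edge : ∀ {VS Q x0 x y} → (x0 ≡ a ⊎ x0 ≡ b) → Walk direct (λ x → x ∈ VS × x ≢ x0) Q x y → Walk direct (_∈ VS) (λ e → Q e × e ≢ zero) x y
    avoid-direct-edge h (here x) = here (proj₁ x)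
    avoid-direct-edge {x0 = x0} h (step e (am , ax) q c r) with e ≟ zero
    ... | no nz = step e am (q , nz) c (avoid-direct-edge h r)
    ... | yes refl with Graph.joins-ends direct {zero} c | h
    ...   | inj₁ (refl , refl) | inj₁ refl = ⊥-elim (ax refl)
    ...   | inj₁ (refl , refl) | inj₂ refl = ⊥-elim (proj₂ (Graph.walk-head direct r) refl)
    ...   | inj₂ (refl , refl) | inj₁ refl = ⊥-elim (proj₂ (Graph.walk-head direct r) refl)
    ...   | inj₂ (refl , refl) | inj₂ refl = ⊥-elim (ax refl)

    module Insert {VS ES} (cand : Graph.TwoConn direct 2 VS (inside ∷ ES)) where
      wf : WellFormed direct VS (inside ∷ ES)
      wf = proj₁ cand
      cs : ConnSub direct VS (inside ∷ ES)
      cs = proj₁ (proj₁ (proj₂ cand))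
      tc : ∀ z → z ∈ VS → ∀ x y → x ∈ VS → y ∈ VS → x ≢ z → y ≢ z → Walk direct (λ w → w ∈ VS × w ≢ z) (_∈ inside ∷ ES) x y
      tc = proj₂ (proj₁ (proj₂ cand))
      am : a ∈ VS
      am = proj₁ (wf zero here)
      bm : b ∈ VS
      bm = proj₂ (wf zero here)
      un : u ∉ VS
      un = u∉direct cand
      Avoiding : Fin n → Fin n → Set
      Avoiding = Walk direct (_∈ VS) (NotAB (inside ∷ ES))

      -- a and b are also connected without the edge {a, b}, through-u a third vertex
      a⇝b-avoiding : Avoiding a b
      a⇝b-avoiding with member-≢ (inside ∷ ES) (proj₂ (proj₂ cand)) zero
      ... | zero , _ , ne = ⊥-elim (ne refl)
      ... | suc i , im , _ = go (proj₁ (rest i) ≟ a) (proj₁ (rest i) ≟ b) (proj₂ (rest i) ≟ a) (proj₂ (rest i) ≟ b)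
        where
        p q : Fin n
        p = proj₁ (rest i)
        q = proj₂ (rest i)
        pm : p ∈ VS
        pm = proj₁ (wf (suc i) im)
        qm : q ∈ VS
        qm = proj₂ (wf (suc i) im)
        viaT : ∀ {t} → t ∈ VS → t ≢ a → t ≢ b → Avoiding a b
        viaT {t} tm ta tb = Graph._++w_ direct (avoid-direct-edge (inj₂ refl) (tc b bm a t am tm a≢b tb))
                                        (avoid-direct-edge (inj₁ refl) (tc a am t b tm bm ta (a≢b ∘ sym)))
        go : Dec (p ≡ a) → Dec (p ≡ b) → Dec (q ≡ a) → Dec (q ≡ b) → Avoiding a b
        go (no pa) (no pb) _ _ = viaT pm pa pb
        go _ _ (no qa) (no qb) = viaT qm qa qb
        go (yes pa) _ (yes qa) _ = ⊥-elim (rest-loopless i (trans pa (sym qa)))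
        go _ (yes pb) _ (yes qb) = ⊥-elim (rest-loopless i (trans pb (sym qb)))
        go (yes pa) _ (no _) (yes qb) = step (suc i) am (im , λ ()) (inj₁ (cong₂ _,_ pa qb)) (here bm)
        go (no _) (yes pb) (yes qa) _ = step (suc i) am (im , λ ()) (inj₂ (cong₂ _,_ pb qa)) (here bm)

      avoiding-ab : ∀ {x y} → x ∈ VS → y ∈ VS → Avoiding x y
      avoiding-ab {x} {y} xm ym with x ≟ a | y ≟ a | x ≟ b | y ≟ b
      ... | no xa | no ya | _ | _ = avoid-direct-edge (inj₁ refl) (tc a am x y xm ym xa ya)
      ... | _ | _ | no xb | no yb = avoid-direct-edge (inj₂ refl) (tc b bm x y xm ym xb yb)
      ... | yes refl | _ | yes e | _ = ⊥-elim (a≢b e)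
      ... | _ | yes refl | _ | yes e = ⊥-elim (a≢b e)
      ... | yes refl | no _ | no _ | yes refl = a⇝b-avoiding
      ... | no _ | yes refl | yes refl | no _ = Graph.walk-reverse direct a⇝b-avoiding

      VS₂ : Subset n
      VS₂ = VS [ u ]≔ inside
      ES₂ : Subset (suc (suc r))
      ES₂ = inside ∷ inside ∷ ES

      keep : ∀ {x} → x ∈ VS → x ∈ VS₂
      keep = ∈-insert⁺
      u∈₂ : u ∈ VS₂
      u∈₂ = ∈-inserted

      wf₂ : WellFormed subdivided VS₂ ES₂
      wf₂ zero here = keep am , u∈₂
      wf₂ (suc zero) (there here) = u∈₂ , keep bm
      wf₂ (suc (suc i)) (there (there m)) = keep (proj₁ (wf (suc i) (there m))) , keep (proj₂ (wf (suc i) (there m)))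

      lift-walk : ∀ (Z : Fin n → Set) → Z u → ∀ {x y} → Walk direct (λ x → x ∈ VS × Z x) (_∈ inside ∷ ES) x y
          → Walk subdivided (λ x → x ∈ VS₂ × Z x) (_∈ ES₂) x y
      lift-walk Z zu = walk-bind id (λ (m , z) → keep m , z) lift-edge
        where
        lift-edge : ∀ e {x y} → (x ∈ VS × Z x) → e ∈ inside ∷ ES → Joins direct e x y → (y ∈ VS × Z y)
           → Walk subdivided (λ x → x ∈ VS₂ × Z x) (_∈ ES₂) x y
        lift-edge (suc i) px (there m) j py = step (suc (suc i)) (keep (proj₁ px) , proj₂ px) (there (there m)) j (here (keep (proj₁ py) , proj₂ py))
        lift-edge zero {x} {y} px here j py with Graph.joins-ends direct {zero} j
        ... | inj₁ (refl , refl) = step zero (keep (proj₁ px) , proj₂ px) here (inj₁ refl)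
                                    (step (suc zero) (u∈₂ , zu) (there here) (inj₁ refl) (here (keep (proj₁ py) , proj₂ py)))
        ... | inj₂ (refl , refl) = step (suc zero) (keep (proj₁ px) , proj₂ px) (there here) (inj₂ refl)
                                    (step zero (u∈₂ , zu) here (inj₂ refl) (here (keep (proj₁ py) , proj₂ py)))

      u-to-end : ∀ {P : Fin n → Set} {c} → c ≡ a ⊎ c ≡ b → P u → P c → Walk subdivided P (_∈ ES₂) u c
      u-to-end (inj₁ refl) pu pc = step zero pu here (inj₂ refl) (here pc)
      u-to-end (inj₂ refl) pu pc = step (suc zero) pu (there here) (inj₁ refl) (here pc)

      through-u : ∀ {P : Fin n → Set} (c : Fin n) → c ≡ a ⊎ c ≡ b → P c → P u
          → (∀ {x y} → x ∈ VS → y ∈ VS → P x → P y → Walk subdivided P (_∈ ES₂) x y)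
          → ∀ {x y} → x ∈ VS₂ → y ∈ VS₂ → P x → P y → Walk subdivided P (_∈ ES₂) x y
      through-u {P} c cab pc pu core {x} {y} xm ym px py with ∈-insert⁻ xm | ∈-insert⁻ ym
      ... | inj₁ xm' | inj₁ ym' = core xm' ym' px py
      ... | inj₂ refl | inj₁ ym' = Graph._++w_ subdivided (u-to-end cab pu pc) (core cmV ym' pc py)
        where cmV : c ∈ VS
              cmV = [ (λ e → subst (_∈ VS) (sym e) am) , (λ e → subst (_∈ VS) (sym e) bm) ]′ cab
      ... | inj₁ xm' | inj₂ refl = Graph._++w_ subdivided (core xm' cmV px pc) (Graph.walk-reverse subdivided (u-to-end cab pu pc))
        where cmV : c ∈ VS
              cmV = [ (λ e → subst (_∈ VS) (sym e) am) , (λ e → subst (_∈ VS) (sym e) bm) ]′ cab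
      ... | inj₂ refl | inj₂ refl = here pu

      connected₂ : ConnSub subdivided VS₂ ES₂
      connected₂ x y xm ym = Graph.walk-mono subdivided proj₁ id
        (through-u {λ x → x ∈ VS₂ × ⊤} a (inj₁ refl) (keep am , tt) (u∈₂ , tt)
          (λ xm ym _ _ → lift-walk (λ _ → ⊤) tt (Graph.walk-mono direct (λ m → m , tt) id (cs _ _ xm ym))) xm ym (xm , tt) (ym , tt))

      two-connected₂ : TwoConnSub subdivided VS₂ ES₂
      two-connected₂ = connected₂ , tc'
        where
        tc' : ∀ z → z ∈ VS₂ → ∀ x y → x ∈ VS₂ → y ∈ VS₂ → x ≢ z → y ≢ z → Walk subdivided (λ w → w ∈ VS₂ × w ≢ z) (_∈ ES₂) x y
        tc' z zm x y xm ym nx ny with ∈-insert⁻ zm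
        ... | inj₂ refl with ∈-insert⁻ xm | ∈-insert⁻ ym
        ...   | inj₁ xm' | inj₁ ym' = walk-up-avoiding (λ m → keep m , λ e → un (subst (_∈ VS) e m)) (avoiding-ab xm' ym')
        ...   | inj₂ e | _ = ⊥-elim (nx e)
        ...   | _ | inj₂ e = ⊥-elim (ny e)
        tc' z zm x y xm ym nx ny | inj₁ zm' with a ≟ z
        ... | yes refl = through-u {λ w → w ∈ VS₂ × w ≢ a} b (inj₂ refl) (keep bm , a≢b ∘ sym) (u∈₂ , u≢a)
              (λ xm' ym' px py → lift-walk (_≢ a) u≢a (tc a zm' _ _ xm' ym' (proj₂ px) (proj₂ py))) xm ym (xm , nx) (ym , ny)
        ... | no na = through-u {λ w → w ∈ VS₂ × w ≢ z} a (inj₁ refl) (keep am , na) (u∈₂ , λ e → un (subst (_∈ VS) (sym e) zm'))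
              (λ xm' ym' px py → lift-walk (_≢ z) (λ e → un (subst (_∈ VS) (sym e) zm')) (tc z zm' _ _ xm' ym' (proj₂ px) (proj₂ py))) xm ym (xm , nx) (ym , ny)

      candidate₂ : Graph.TwoConn subdivided 2 VS₂ ES₂
      candidate₂ = wf₂ , two-connected₂ , ℕP.≤-trans (proj₂ (proj₂ cand)) (ℕP.n≤1+n _)

    F-TwoConn : ∀ X → TwoConn′ direct 2 X → TwoConn′ subdivided 2 (F X)
    F-TwoConn (VS , inside ∷ ES) cand = Insert.candidate₂ cand
    F-TwoConn (VS , outside ∷ ES) cand@(wf , (cs , tc) , bl) = wf' , (cs' , tc') , bl
      where
      wf' : WellFormed subdivided VS (outside ∷ outside ∷ ES)
      wf' (suc (suc i)) (there (there m)) = wf (suc i) (there m)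
      cs' : ConnSub subdivided VS (outside ∷ outside ∷ ES)
      cs' x y xm ym = walk-up-outside (cs x y xm ym)
      tc' : ∀ z → z ∈ VS → ∀ x y → x ∈ VS → y ∈ VS → x ≢ z → y ≢ z
          → Walk subdivided (λ w → w ∈ VS × w ≢ z) (_∈ outside ∷ outside ∷ ES) x y
      tc' z zm x y xm ym nx ny = walk-up-outside (tc z zm x y xm ym nx ny)

    FV⊇ : ∀ VS c ES → VS ⊆ proj₁ (F (VS , c ∷ ES))
    FV⊇ VS inside ES m = ∈-insert⁺ m
    FV⊇ VS outside ES m = m

    FE≡ : ∀ VS c ES → proj₂ (F (VS , c ∷ ES)) ≡ c ∷ c ∷ ES
    FE≡ VS inside ES = refl
    FE≡ VS outside ES = refl

    drop2 : ∀ {c c1 c2 : Bool} {ES ES' : Subset r} → (c ∷ c ∷ ES ⊆ c1 ∷ c2 ∷ ES') → c ∷ ES ⊆ c1 ∷ ES'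
    drop2 s {zero} here with s here
    ... | here = here
    drop2 s {suc i} (there m) with s (there (there m))
    ... | there (there m') = there m'

    F⊆⇒⊆H : ∀ X Y → TwoConn′ direct 2 X → TwoConn′ subdivided 2 Y → F X ⊆₂ Y → X ⊆₂ H Y
    F⊆⇒⊆H (VS , c ∷ ES) (VS' , c1 ∷ c2 ∷ ES') gx gy (s1 , s2) =
      (λ {v} m → ∈-remove⁺ (s1 (FV⊇ VS c ES m)) (λ e → u∉direct gx (subst (_∈ VS) e m))) ,
      drop2 (subst (_⊆ c1 ∷ c2 ∷ ES') (FE≡ VS c ES) s2)

    uFV : ∀ VS ES → u ∈ proj₁ (F (VS , inside ∷ ES))
    uFV VS ES = ∈-inserted

    H≡⇒⊆F : ∀ X Y → TwoConn′ direct 2 X → TwoConn′ subdivided 2 Y → H Y ≡ X → Y ⊆₂ F X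
    H≡⇒⊆F X (VS' , c1 ∷ c2 ∷ ES') gx gy refl = vs , es
      where
      vs : VS' ⊆ proj₁ (F (VS' [ u ]≔ outside , c1 ∷ ES'))
      vs {w} m with w ≟ u
      ... | yes refl = subst (λ k → u ∈ proj₁ (F (VS' [ u ]≔ outside , k ∷ ES'))) (sym (first-by-u∈ gy m)) (uFV _ ES')
      ... | no nw = FV⊇ _ c1 ES' (∈-remove⁺ m nw)
      es : c1 ∷ c2 ∷ ES' ⊆ proj₂ (F (VS' [ u ]≔ outside , c1 ∷ ES'))
      es m rewrite FE≡ (VS' [ u ]≔ outside) c1 ES' | halves-agree gy = m

    H⊆⇒⊆F : ∀ Y X → TwoConn′ subdivided 2 Y → TwoConn′ direct 2 X → H Y ⊆₂ X → Y ⊆₂ F X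
    H⊆⇒⊆F (VS' , c1 ∷ c2 ∷ ES') (VS , c ∷ ES) gy gx (s1 , s2) = vs , es
      where
      cin : c1 ≡ inside → c ≡ inside
      cin refl with s2 here
      ... | here = refl
      vs : VS' ⊆ proj₁ (F (VS , c ∷ ES))
      vs {w} m with w ≟ u
      ... | yes refl = subst (λ k → u ∈ proj₁ (F (VS , k ∷ ES))) (sym (cin (first-by-u∈ gy m))) (uFV VS ES)
      ... | no nw = FV⊇ VS c ES (s1 (∈-remove⁺ m nw))
      es : c1 ∷ c2 ∷ ES' ⊆ proj₂ (F (VS , c ∷ ES))
      es {e} m rewrite FE≡ VS c ES = go e m
        where
        go : ∀ e → e ∈ c1 ∷ c2 ∷ ES' → e ∈ c ∷ c ∷ ES
        go zero here = subst (λ k → zero ∈ k ∷ k ∷ ES) (sym (cin refl)) here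
        go (suc zero) (there here) = subst (λ k → suc zero ∈ k ∷ k ∷ ES) (sym (cin (halves-agree gy))) (there here)
        go (suc (suc i)) (there (there m)) with s2 (there m)
        ... | there m' = there (there m')

    F≡⇒⊆H : ∀ Y X → TwoConn′ subdivided 2 Y → TwoConn′ direct 2 X → F X ≡ Y → X ⊆₂ H Y
    F≡⇒⊆H Y (VS , inside ∷ ES) gy gx refl = (λ {v} m → ∈-remove⁺ (∈-insert⁺ m) (λ e → u∉direct gx (subst (_∈ VS) e m))) , (λ m → m)
    F≡⇒⊆H Y (VS , outside ∷ ES) gy gx refl = (λ {v} m → ∈-remove⁺ m (λ e → u∉direct gx (subst (_∈ VS) e m))) , (λ m → m)

    -- F and H change the edge and vertex counts together
    retF : ∀ X → TwoConn′ direct 2 X → retSub subdivided (proj₁ (F X)) (proj₂ (F X)) ≡ retSub direct (proj₁ X) (proj₂ X)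
    retF (VS , inside ∷ ES) gx = trans (Graph.retSub-by-cards subdivided (VS [ u ]≔ inside) (inside ∷ inside ∷ ES) refl (∣insert∣ (u∉direct gx))) (ret-shift ∣ inside ∷ ES ∣ ∣ VS ∣)
    retF (VS , outside ∷ ES) gx = refl

    retH : ∀ Y → TwoConn′ subdivided 2 Y → retSub direct (proj₁ (H Y)) (proj₂ (H Y)) ≡ retSub subdivided (proj₁ Y) (proj₂ Y)
    retH (VS , inside ∷ c2 ∷ ES) gy rewrite sym (halves-agree gy) =
      sym (trans (Graph.retSub-by-cards subdivided VS (inside ∷ inside ∷ ES) refl (sym (∣remove∣ (u∈-by-first gy refl)))) (ret-shift ∣ inside ∷ ES ∣ ∣ VS [ u ]≔ outside ∣))
    retH (VS , outside ∷ c2 ∷ ES) gy rewrite sym (halves-agree gy) =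
      cong (λ k → (ℤ.+ ∣ ES ∣ ℤ.- ℤ.+ k) ℤ.+ ℤ.+ 1) (∣remove-∉∣ (λ um → outside≢inside (first-by-u∈ gy um)))

    module Up = MaximalTransfer direct subdivided 2 F H F-TwoConn H-TwoConn F⊆⇒⊆H H≡⇒⊆F
    module Down = MaximalTransfer subdivided direct 2 H F H-TwoConn F-TwoConn H⊆⇒⊆F F≡⇒⊆H

    blobs-up : BlobTransfer direct subdivided
    blobs-up VS ES mx = _ , _ , Up.maximal VS ES mx , retF (VS , ES) (maximal-TwoConn mx)
    blobs-down : BlobTransfer subdivided direct
    blobs-down VS ES mx = _ , _ , Down.maximal VS ES mx , retH (VS , ES) (maximal-TwoConn mx)

    -- a pendant vertex other than u remains pendant after subdividing (if its
    -- edge is {a, b}, the new pendant edge is the half at its end)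
    pendant-subdivided : ∀ {y e0 z} → Graph.Pendant direct y e0 z → y ≢ u → ∃[ y' ] ∃[ e' ] ∃[ z' ] Graph.Pendant subdivided y' e' z'
    pendant-subdivided {y} {suc i} {z} (j , yz , uq) yu = y , suc (suc i) , z , j , yz , h
      where
      h : ∀ e → Graph.Touches subdivided e y → e ≡ suc (suc i)
      h zero (inj₁ x) = case0 (uq zero (inj₁ x))
        where case0 : zero ≡ suc i → _
              case0 ()
      h zero (inj₂ x) = ⊥-elim (yu (sym x))
      h (suc zero) (inj₁ x) = ⊥-elim (yu (sym x))
      h (suc zero) (inj₂ x) = case0 (uq zero (inj₂ x))
        where case0 : zero ≡ suc i → _
              case0 ()
      h (suc (suc k)) t = cong suc (uq (suc k) t)
    pendant-subdivided {y} {zero} {z} (j , yz , uq) yu with Graph.joins-ends direct {zero} j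
    ... | inj₁ (refl , refl) = a , zero , u , inj₁ refl , u≢a ∘ sym , h
      where
      h : ∀ e → Graph.Touches subdivided e a → e ≡ zero
      h zero t = refl
      h (suc zero) (inj₁ x) = ⊥-elim (u≢a x)
      h (suc zero) (inj₂ x) = ⊥-elim (a≢b (sym x))
      h (suc (suc k)) t = case0 (uq (suc k) t)
        where case0 : suc k ≡ zero → _
              case0 ()
    ... | inj₂ (refl , refl) = b , suc zero , u , inj₂ refl , u≢b ∘ sym , h
      where
      h : ∀ e → Graph.Touches subdivided e b → e ≡ suc zero
      h zero (inj₁ x) = ⊥-elim (a≢b x)
      h zero (inj₂ x) = ⊥-elim (u≢b x)
      h (suc zero) t = refl
      h (suc (suc k)) t = case0 (uq (suc k) t)
        where case0 : suc k ≡ zero → _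
              case0 ()

    subdivision-same-level : ∀ {y e₀ z} → Graph.Pendant direct y e₀ z → y ≢ u → SameLevel direct subdivided
    subdivision-same-level pendant y≢u =
      transfers-same-level (blob-transfer direct-loopless zero-subdivided blobs-up)
                 (blob-transfer subdivided-loopless (Graph.pendant-bicomp direct direct-loopless pendant) blobs-down)
      where
      zero-subdivided : Graph.ZeroBiComp subdivided
      zero-subdivided with pendant-subdivided pendant y≢u
      ... | _ , _ , _ , pendant′ = Graph.pendant-bicomp subdivided subdivided-loopless pendant′

-- Being a biconnected component is decidable (walks
-- are decided by saturating the set of reachable vertices), so the maximum of
-- ret over the finitely many biconnected components can be computed; it
-- exists as soon as there is one biconnected component.

all-subsets? : ∀ {n} {P : Subset n → Set} → (∀ p → Dec (P p)) → Dec (∀ p → P p)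
all-subsets? {P = P} P? with anySubset? (λ p → ¬? (P? p))
... | yes (p , ¬Pp) = no (λ all → ¬Pp (all p))
... | no  none      = yes λ p → holds p (P? p)
  where
  holds : ∀ p → Dec (P p) → P p
  holds p (yes Pp)  = Pp
  holds p (no  ¬Pp) = ⊥-elim (none (p , ¬Pp))

⊈-witness : ∀ {n} {p q : Subset n} → ¬ (p ⊆ q) → ∃[ x ] (x ∈ p × x ∉ q)
⊈-witness {p = p} {q} p⊈q with any? (λ x → (x ∈? p) ×-dec ¬? (x ∈? q))
... | yes witness = witness
... | no  none    = ⊥-elim (p⊈q λ {x} x∈p → in-q x x∈p (x ∈? q))
  where
  in-q : ∀ x → x ∈ p → Dec (x ∈ q) → x ∈ q
  in-q x _   (yes x∈q) = x∈q
  in-q x x∈p (no  x∉q) = ⊥-elim (none (x , x∈p , x∉q))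

module Decide {n m : ℕ} (ends : Fin m → Fin n × Fin n) where
  open Graph ends using (walk-head; walk-snoc)

  joins? : ∀ e x w → Dec (Joins ends e x w)
  joins? e x w = ×-≡-dec _≟_ _≟_ (ends e) (x , w) ⊎-dec ×-≡-dec _≟_ _≟_ (ends e) (w , x)

  module Reachability {P : Fin n → Set} {Q : Fin m → Set} (P? : ∀ x → Dec (P x)) (Q? : ∀ e → Dec (Q e)) (u : Fin n) where
    Sound : Subset n → Set
    Sound R = ∀ w → w ∈ R → Walk ends P Q u w
    Closed : Subset n → Set
    Closed C = ∀ e x w → x ∈ C → Q e → Joins ends e x w → P w → w ∈ C

    OneStep : Subset n → Fin n → Set
    OneStep R w = w ∈ R ⊎ (P w × ∃[ e ] (Q e × ∃[ x ] (x ∈ R × Joins ends e x w)))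
    OneStep? : ∀ R w → Dec (OneStep R w)
    OneStep? R w = (w ∈? R) ⊎-dec (P? w ×-dec any? (λ e → Q? e ×-dec any? (λ x → (x ∈? R) ×-dec joins? e x w)))
    next : Subset n → Subset n
    next R = subsetOf (OneStep? R)

    ⊆next : ∀ R → R ⊆ next R
    ⊆next R x∈ = subsetOf⁺ (OneStep? R) (inj₁ x∈)

    next-sound : ∀ R → Sound R → Sound (next R)
    next-sound R sound w w∈ with subsetOf⁻ (OneStep? R) w∈
    ... | inj₁ w∈R = sound w w∈R
    ... | inj₂ (pw , e , qe , x , x∈ , j) = walk-snoc (sound x x∈) e qe j pw

    -- iterate  next  until it stabilises; each proper step adds a vertex, so
    -- fuel k with  n < ∣ R ∣ + k  suffices
    saturate : (k : ℕ) (R : Subset n) → n < ∣ R ∣ + k → Sound R → Σ (Subset n) λ C → Sound C × Closed C × R ⊆ C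
    saturate k R fuel sound with next R ⊆? R
    ... | yes stable = R , sound , (λ e x w x∈ qe j pw → stable (subsetOf⁺ (OneStep? R) (inj₂ (pw , e , qe , x , x∈ , j)))) , id
    saturate zero R fuel sound | no _ = ⊥-elim (ℕP.<⇒≱ fuel (subst (_≤ n) (sym (ℕP.+-identityʳ _)) (∣p∣≤n R)))
    saturate (suc k) R fuel sound | no grows with ⊈-witness grows
    ... | x , x∈next , x∉R with saturate k (next R) fuel′ (next-sound R sound)
      where
      bigger : suc ∣ R ∣ ≤ ∣ next R ∣
      bigger = subst (suc ∣ R ∣ ≤_) (∣remove∣ x∈next)
                 (s≤s (p⊆q⇒∣p∣≤∣q∣ (λ {y} y∈ → ∈-remove⁺ (⊆next R y∈) (λ e → x∉R (subst (_∈ R) e y∈)))))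
      fuel′ : n < ∣ next R ∣ + k
      fuel′ = ℕP.<-≤-trans fuel (subst (_≤ ∣ next R ∣ + k) (sym (ℕP.+-suc ∣ R ∣ k)) (ℕP.+-monoˡ-≤ k bigger))
    ... | C , sound′ , closed , R⊆C = C , sound′ , closed , R⊆C ∘ ⊆next R

    closed-complete : ∀ {C} → Closed C → ∀ {x v} → x ∈ C → Walk ends P Q x v → v ∈ C
    closed-complete closed x∈ (here _)           = x∈
    closed-complete closed x∈ (step e px qe j r) = closed-complete closed (closed e _ _ x∈ qe j (walk-head r)) r

    walk? : ∀ v → Dec (Walk ends P Q u v)
    walk? v with P? u
    ... | no ¬pu = no (¬pu ∘ walk-head)
    ... | yes pu with saturate (suc n) S.⁅ u ⁆ (ℕP.m≤n+m (suc n) _) (λ w w∈ → subst (Walk ends P Q u) (sym (x∈⁅y⁆⇒x≡y u w∈)) (here pu))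
    ...   | C , sound , closed , u∈C with v ∈? C
    ...     | yes v∈ = yes (sound v v∈)
    ...     | no  v∉ = no (λ r → v∉ (closed-complete closed (u∈C (x∈⁅x⁆ u)) r))

  walk? : ∀ {P Q} → (∀ x → Dec (P x)) → (∀ e → Dec (Q e)) → ∀ u v → Dec (Walk ends P Q u v)
  walk? P? Q? u v = Reachability.walk? P? Q? u v

  wellFormed? : ∀ VS ES → Dec (WellFormed ends VS ES)
  wellFormed? VS ES = all? (λ e → (e ∈? ES) →-dec ((proj₁ (ends e) ∈? VS) ×-dec (proj₂ (ends e) ∈? VS)))

  connSub? : ∀ VS ES → Dec (ConnSub ends VS ES)
  connSub? VS ES = all? λ u → all? λ v → (u ∈? VS) →-dec (v ∈? VS) →-dec walk? (_∈? VS) (_∈? ES) u v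

  twoConnSub? : ∀ VS ES → Dec (TwoConnSub ends VS ES)
  twoConnSub? VS ES = connSub? VS ES ×-dec
    (all? λ z → (z ∈? VS) →-dec all? λ u → all? λ v → (u ∈? VS) →-dec (v ∈? VS) →-dec ¬? (u ≟ z) →-dec ¬? (v ≟ z) →-dec
       walk? (λ w → (w ∈? VS) ×-dec ¬? (w ≟ z)) (_∈? ES) u v)

  maxTwoConn? : ∀ b VS ES → Dec (MaxTwoConn ends b VS ES)
  maxTwoConn? b VS ES = wellFormed? VS ES ×-dec twoConnSub? VS ES ×-dec (b ℕP.≤? ∣ ES ∣) ×-dec
    all-subsets? (λ VS′ → all-subsets? λ ES′ → wellFormed? VS′ ES′ →-dec twoConnSub? VS′ ES′ →-dec
      (VS ⊆? VS′) →-dec (ES ⊆? ES′) →-dec (VecP.≡-dec Bool._≟_ VS′ VS ×-dec VecP.≡-dec Bool._≟_ ES′ ES))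

subsets : ∀ n → List (Subset n)
subsets zero    = [] ∷ []
subsets (suc n) = map (inside ∷_) (subsets n) ++ map (outside ∷_) (subsets n)

∈-subsets : ∀ {n} (p : Subset n) → p ∈L subsets n
∈-subsets []            = Any.here refl
∈-subsets (inside ∷ p)  = ∈-++⁺ˡ (∈-map⁺ (inside ∷_) (∈-subsets p))
∈-subsets {suc n} (outside ∷ p) = ∈-++⁺ʳ (map (inside ∷_) (subsets n)) (∈-map⁺ (outside ∷_) (∈-subsets p))

level-exists : ∀ {n m} (ends : Fin m → Fin n × Fin n) → ∀ VS₀ ES₀ → BiComp ends VS₀ ES₀ → ∃[ l ] IsLevel ends l
level-exists {n} {m} ends VS₀ ES₀ bc₀ = ret X* , bound , proj₁ X* , proj₂ X* , bc* , refl
  where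
  ret : Subset n × Subset m → ℤ.ℤ
  ret (VS , ES) = retSub ends VS ES
  BiComp? : ∀ X → Dec (BiComp ends (proj₁ X) (proj₂ X))
  BiComp? (VS , ES) = Decide.maxTwoConn? ends 1 VS ES
  components : List (Subset n × Subset m)
  components = filter BiComp? (cartesianProduct (subsets n) (subsets m))
  X* : Subset n × Subset m
  X* = Extrema.argmax ret (VS₀ , ES₀) components
  bc* : BiComp ends (proj₁ X*) (proj₂ X*)
  bc* with Extrema.argmax-sel ret (VS₀ , ES₀) components
  ... | inj₁ X*≡X₀ = subst (λ X → BiComp ends (proj₁ X) (proj₂ X)) (sym X*≡X₀) bc₀
  ... | inj₂ X*∈   = proj₂ (∈-filter⁻ BiComp? {xs = cartesianProduct (subsets n) (subsets m)} X*∈)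
  bound : ∀ VS ES → BiComp ends VS ES → retSub ends VS ES ℤ.≤ ret X*
  bound VS ES bc = Extrema.v≤f[argmax]⁺ {f = ret} (VS₀ , ES₀) components (inj₂ (Any.map (λ eq → ℤP.≤-reflexive (cong ret eq)) listed))
    where
    listed : (VS , ES) ∈L components
    listed = ∈-filter⁺ BiComp? (∈-cartesianProduct⁺ (∈-subsets VS) (∈-subsets ES)) bc

pendant-level-exists : ∀ {n m} (ends : Fin m → Fin n × Fin n) → Graph.Loopless ends
  → ∀ {y e₀ z} → Graph.Pendant ends y e₀ z → ∃[ l ] IsLevel ends l
pendant-level-exists ends loopless pendant with Graph.pendant-bicomp ends loopless pendant
... | VS , ES , bc , _ = level-exists ends VS ES bc

-- A pseudo-network stores its edges as a list es, which we read
-- as the graph  lookup es : Fin (length es) → Fin n × Fin n.  Permuting the list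
-- or relating it elementwise yields edge bijections between these graphs.

Edge : ℕ → Set
Edge n = Fin n × Fin n

ebij-refl : ∀ {A : Set} {m} {R : A → A → Set} {e : Fin m → A} → (∀ i → R (e i) (e i)) → EBij R e e
ebij-refl related = record { f = id ; g = id ; gf = λ _ → refl ; fg = λ _ → refl ; rel = related }

ebij-cons : ∀ {A B : Set} {R : A → B → Set} {x y xs ys} → EBij R (lookup xs) (lookup ys) → R x y
  → EBij R (lookup (x ∷ xs)) (lookup (y ∷ ys))
ebij-cons {xs = xs} {ys} b rxy = record { f = f′ ; g = g′ ; gf = gf′ ; fg = fg′ ; rel = rel′ }
  where
  open EBij b
  f′ : Fin (suc (length xs)) → Fin (suc (length ys))
  f′ zero    = zero
  f′ (suc i) = suc (f i)
  g′ : Fin (suc (length ys)) → Fin (suc (length xs))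
  g′ zero    = zero
  g′ (suc i) = suc (g i)
  gf′ : ∀ i → g′ (f′ i) ≡ i
  gf′ zero    = refl
  gf′ (suc i) = cong suc (gf i)
  fg′ : ∀ i → f′ (g′ i) ≡ i
  fg′ zero    = refl
  fg′ (suc i) = cong suc (fg i)
  rel′ : ∀ i → _
  rel′ zero    = rxy
  rel′ (suc i) = rel i

ebij-swap : ∀ {A : Set} {x y : A} {xs ys} → EBij _≡_ (lookup xs) (lookup ys)
  → EBij _≡_ (lookup (x ∷ y ∷ xs)) (lookup (y ∷ x ∷ ys))
ebij-swap {xs = xs} {ys} b = record { f = f′ ; g = g′ ; gf = gf′ ; fg = fg′ ; rel = rel′ }
  where
  open EBij b
  f′ : Fin (suc (suc (length xs))) → Fin (suc (suc (length ys)))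
  f′ zero          = suc zero
  f′ (suc zero)    = zero
  f′ (suc (suc i)) = suc (suc (f i))
  g′ : Fin (suc (suc (length ys))) → Fin (suc (suc (length xs)))
  g′ zero          = suc zero
  g′ (suc zero)    = zero
  g′ (suc (suc i)) = suc (suc (g i))
  gf′ : ∀ i → g′ (f′ i) ≡ i
  gf′ zero          = refl
  gf′ (suc zero)    = refl
  gf′ (suc (suc i)) = cong (λ k → suc (suc k)) (gf i)
  fg′ : ∀ i → f′ (g′ i) ≡ i
  fg′ zero          = refl
  fg′ (suc zero)    = refl
  fg′ (suc (suc i)) = cong (λ k → suc (suc k)) (fg i)
  rel′ : ∀ i → _
  rel′ zero          = refl
  rel′ (suc zero)    = refl
  rel′ (suc (suc i)) = rel i

ebij-perm : ∀ {A : Set} {xs ys : List A} → xs ↭ ys → EBij _≡_ (lookup xs) (lookup ys)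
ebij-perm Perm.refl          = ebij-refl (λ _ → refl)
ebij-perm (Perm.prep x p)    = ebij-cons (ebij-perm p) refl
ebij-perm (Perm.swap x y p)  = ebij-swap (ebij-perm p)
ebij-perm (Perm.trans p q)   = ebij-trans (ebij-perm p) (ebij-perm q) trans

ebij-pointwise : ∀ {A B : Set} {R : A → B → Set} {xs ys} → Pointwise R xs ys → EBij R (lookup xs) (lookup ys)
ebij-pointwise []        = record { f = λ () ; g = λ () ; gf = λ () ; fg = λ () ; rel = λ () }
ebij-pointwise (r ∷ rs)  = ebij-cons (ebij-pointwise rs) r

ebij-tabulate : ∀ {A : Set} {m} (e : Fin m → A) → EBij _≡_ e (lookup (tabulate e))
ebij-tabulate e = record
  { f   = cast (sym (length-tabulate e))
  ; g   = cast (length-tabulate e)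
  ; gf  = cast-involutive (length-tabulate e) (sym (length-tabulate e))
  ; fg  = cast-involutive (sym (length-tabulate e)) (length-tabulate e)
  ; rel = λ i → sym (lookup-tabulate e i) }

degP : ∀ {n} → Edge n → Fin n → ℕ
degP (a , b) v = ind (a ≟ v) + ind (b ≟ v)

degL-cons : ∀ {n} (p : Edge n) xs v → degL (p ∷ xs) v ≡ degP p v + degL xs v
degL-cons (a , b) xs v = refl

ind-yes : ∀ {n} {a v : Fin n} → a ≡ v → ind (a ≟ v) ≡ 1
ind-yes {a = a} {v} a≡v with a ≟ v
... | yes _   = refl
... | no  a≢v = ⊥-elim (a≢v a≡v)

ind-no : ∀ {n} {a v : Fin n} → a ≢ v → ind (a ≟ v) ≡ 0
ind-no {a = a} {v} a≢v with a ≟ v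
... | yes a≡v = ⊥-elim (a≢v a≡v)
... | no  _   = refl

ind≡0⇒≢ : ∀ {n} {a v : Fin n} → ind (a ≟ v) ≡ 0 → a ≢ v
ind≡0⇒≢ {a = a} {v} ind≡0 a≡v with a ≟ v
... | no a≢v = a≢v a≡v

ind≤1 : ∀ {n} (a v : Fin n) → ind (a ≟ v) ≤ 1
ind≤1 a v with a ≟ v
... | yes _ = s≤s z≤n
... | no  _ = z≤n

degP-UEq : ∀ {n} {p q : Edge n} → UEq p q → ∀ v → degP p v ≡ degP q v
degP-UEq (inj₁ refl) v = refl
degP-UEq {q = a , b} (inj₂ refl) v = ℕP.+-comm (ind (b ≟ v)) (ind (a ≟ v))

degL-↭ : ∀ {n} {xs ys : List (Edge n)} → xs ↭ ys → ∀ v → degL xs v ≡ degL ys v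
degL-↭ Perm.refl                  v = refl
degL-↭ (Perm.prep p xs↭ys)        v = cong (degP p v +_) (degL-↭ xs↭ys v)
degL-↭ (Perm.swap {xs} p q xs↭ys) v = trans (swap-middle (degP p v) (degP q v) (degL xs v))
                                         (cong (λ k → degP q v + (degP p v + k)) (degL-↭ xs↭ys v))
  where
  swap-middle : ∀ x y z → x + (y + z) ≡ y + (x + z)
  swap-middle x y z = trans (sym (ℕP.+-assoc x y z)) (trans (cong (_+ z) (ℕP.+-comm x y)) (ℕP.+-assoc y x z))
degL-↭ (Perm.trans p q)           v = trans (degL-↭ p v) (degL-↭ q v)

deg≡degL-tabulate : ∀ {n m} (ends : Fin m → Edge n) v → deg ends v ≡ degL (tabulate ends) v
deg≡degL-tabulate {m = zero}  ends v = refl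
deg≡degL-tabulate {m = suc m} ends v = cong (degP (ends zero) v +_) (deg≡degL-tabulate (ends ∘ suc) v)

deg≡degL : ∀ {n m} (ends : Fin m → Edge n) v → deg ends v ≡ degL (map ends (allFin m)) v
deg≡degL ends v = trans (deg≡degL-tabulate ends v) (cong (λ es → degL es v) (sym (map-tabulate id ends)))

AtVertex : ∀ {n} → Fin n → Edge n → Set
AtVertex v p = proj₁ p ≡ v ⊎ proj₂ p ≡ v

at? : ∀ {n} (v : Fin n) (p : Edge n) → Dec (AtVertex v p)
at? v p = (proj₁ p ≟ v) ⊎-dec (proj₂ p ≟ v)

NonLoop : ∀ {n} → Edge n → Set
NonLoop p = proj₁ p ≢ proj₂ p

length-at : ∀ {n} {xs : List (Edge n)} → All NonLoop xs → ∀ v → length (filter (at? v) xs) ≡ degL xs v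
length-at [] v = refl
length-at {xs = (a , b) ∷ xs} (a≢b ∷ rest) v with a ≟ v | b ≟ v
... | yes refl | yes refl = ⊥-elim (a≢b refl)
... | yes refl | no _     = cong suc (length-at rest v)
... | no _     | yes refl = cong suc (length-at rest v)
... | no _     | no _     = length-at rest v

partition-↭ : ∀ {A : Set} {P : A → Set} (P? : ∀ x → Dec (P x)) (xs : List A)
  → xs ↭ filter P? xs ++ filter (¬? ∘ P?) xs
partition-↭ P? []       = Perm.refl
partition-↭ P? (x ∷ xs) with P? x
... | yes _ = Perm.prep x (partition-↭ P? xs)
... | no  _ = Perm.trans (Perm.prep x (partition-↭ P? xs)) (↭-sym (shift x (filter P? xs) _))

All-index : ∀ {A : Set} {P : A → Set} {xs : List A} → All P xs → ∀ i → P (lookup xs i)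
All-index (px ∷ _)   zero    = px
All-index (_  ∷ pxs) (suc i) = All-index pxs i

degL≡0⇒untouched : ∀ {n} (xs : List (Edge n)) y → degL xs y ≡ 0 → ∀ i → ¬ Graph.Touches (lookup xs) i y
degL≡0⇒untouched ((a , b) ∷ xs) y deg≡0 zero (inj₁ a≡y) =
  ind≡0⇒≢ (ℕP.m+n≡0⇒m≡0 _ (ℕP.m+n≡0⇒m≡0 _ deg≡0)) a≡y
degL≡0⇒untouched ((a , b) ∷ xs) y deg≡0 zero (inj₂ b≡y) =
  ind≡0⇒≢ (ℕP.m+n≡0⇒n≡0 (ind (a ≟ y)) (ℕP.m+n≡0⇒m≡0 _ deg≡0)) b≡y
degL≡0⇒untouched ((a , b) ∷ xs) y deg≡0 (suc i) t =
  degL≡0⇒untouched xs y (ℕP.m+n≡0⇒n≡0 (ind (a ≟ y) + ind (b ≟ y)) deg≡0) i t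

-- a vertex of degree 1 is pendant (in a list, a degree-1 vertex is on no loop)
degL≡1⇒pendant : ∀ {n} (xs : List (Edge n)) y → degL xs y ≡ 1 → ∃[ e₀ ] ∃[ z ] Graph.Pendant (lookup xs) y e₀ z
degL≡1⇒pendant ((a , b) ∷ xs) y deg≡1 with a ≟ y | b ≟ y
... | yes refl | yes refl = ⊥-elim (ℕP.<-irrefl refl (ℕP.≤-trans (s≤s (s≤s z≤n)) (ℕP.≤-reflexive deg≡1)))
... | yes refl | no b≢a   = zero , b , inj₁ refl , (b≢a ∘ sym) , only-zero
  where
  only-zero : ∀ e → Graph.Touches (lookup ((a , b) ∷ xs)) e a → e ≡ zero
  only-zero zero    _ = refl
  only-zero (suc i) t = ⊥-elim (degL≡0⇒untouched xs a (ℕP.suc-injective deg≡1) i t)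
... | no a≢b   | yes refl = zero , a , inj₂ refl , (a≢b ∘ sym) , only-zero
  where
  only-zero : ∀ e → Graph.Touches (lookup ((a , b) ∷ xs)) e b → e ≡ zero
  only-zero zero    _ = refl
  only-zero (suc i) t = ⊥-elim (degL≡0⇒untouched xs b (ℕP.suc-injective deg≡1) i t)
... | no a≢y   | no b≢y with degL≡1⇒pendant xs y deg≡1
...   | e₀ , z , j , y≢z , only = suc e₀ , z , j , y≢z , only′
  where
  only′ : ∀ e → Graph.Touches (lookup ((a , b) ∷ xs)) e y → e ≡ suc e₀
  only′ zero    (inj₁ a≡y) = ⊥-elim (a≢y a≡y)
  only′ zero    (inj₂ b≡y) = ⊥-elim (b≢y b≡y)
  only′ (suc i) t          = cong suc (only i t)

degree-two : ∀ {n} (e₁ e₂ : Edge n) rest {a u b} → degL (e₁ ∷ e₂ ∷ rest) u ≡ 2 → UEq e₁ (a , u) → UEq e₂ (u , b)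
  → u ≢ a × u ≢ b × degL rest u ≡ 0
degree-two e₁ e₂ rest {a} {u} {b} deg≡2 j₁ j₂ with arith (ind (a ≟ u)) (ind (b ≟ u)) (degL rest u) (ind≤1 a u) (ind≤1 b u) split
  where
  arith : ∀ x y z → x ≤ 1 → y ≤ 1 → (x + 1) + ((1 + y) + z) ≡ 2 → x ≡ 0 × y ≡ 0 × z ≡ 0
  arith zero zero zero          _ _         _  = refl , refl , refl
  arith zero zero (suc z)       _ _         ()
  arith zero (suc zero) z       _ _         ()
  arith zero (suc (suc y)) z    _ (s≤s ())  _
  arith (suc zero) y z          _ _         ()
  arith (suc (suc x)) y z       (s≤s ()) _  _
  split : (ind (a ≟ u) + 1) + ((1 + ind (b ≟ u)) + degL rest u) ≡ 2
  split = subst (λ k → (ind (a ≟ u) + k) + ((k + ind (b ≟ u)) + degL rest u) ≡ 2) (ind-yes refl)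
    (trans (sym (cong₂ (λ x y → x + (y + degL rest u)) (degP-UEq j₁ u) (degP-UEq j₂ u)))
    (trans (sym (cong (degP e₁ u +_) (degL-cons e₂ rest u))) (trans (sym (degL-cons e₁ (e₂ ∷ rest) u)) deg≡2)))
... | a≢u , b≢u , rest≡0 = ind≡0⇒≢ a≢u ∘ sym , ind≡0⇒≢ b≢u ∘ sym , rest≡0

Distinct : ∀ {n} → Edge n → Edge n → Set
Distinct p q = ¬ UEq p q

Distinct-sym : ∀ {n} {p q : Edge n} → Distinct p q → Distinct q p
Distinct-sym p≉q = p≉q ∘ UEq-sym

simple-nonloops : ∀ {n m} (ends : Fin m → Edge n) → Graph.Loopless ends → All NonLoop (map ends (allFin m))
simple-nonloops ends loopless = subst (All NonLoop) (sym (map-tabulate id ends)) (All-tabulate⁺ loopless)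

simple-distinct : ∀ {n m} (ends : Fin m → Edge n) → (∀ e f → UEq (ends e) (ends f) → e ≡ f)
  → AllPairs Distinct (map ends (allFin m))
simple-distinct ends no-parallel = subst (AllPairs Distinct) (sym (map-tabulate id ends))
  (AllPairsP.tabulate⁺ (λ i≢j same → i≢j (no-parallel _ _ same)))

AllPairs-↭ : ∀ {A : Set} {R : A → A → Set} → (∀ {x y} → R x y → R y x) → ∀ {xs ys} → AllPairs R xs → xs ↭ ys → AllPairs R ys
AllPairs-↭ sym-R pairs Perm.refl = pairs
AllPairs-↭ sym-R (px ∷ pairs) (Perm.prep x p) = All-resp-↭ p px ∷ AllPairs-↭ sym-R pairs p
AllPairs-↭ sym-R ((rxy ∷ rx) ∷ ry ∷ pairs) (Perm.swap x y p) =
  (sym-R rxy ∷ All-resp-↭ p ry) ∷ All-resp-↭ p rx ∷ AllPairs-↭ sym-R pairs p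
AllPairs-↭ sym-R pairs (Perm.trans p q) = AllPairs-↭ sym-R (AllPairs-↭ sym-R pairs p) q

steps : ∀ {n} {P Q : PState n} → Star SuppStep P Q → ℕ
steps ε        = 0
steps (_ ◅ st) = suc (steps st)

suppression-counts : ∀ {n} {P Q : PState n} (st : Star SuppStep P Q)
  → ∣ alive P ∣ ≡ steps st + ∣ alive Q ∣ × length (edges P) ≡ steps st + length (edges Q)
suppression-counts ε = refl , refl
suppression-counts ((u , u∈ , _ , a , b , e₁ , e₂ , rest , _ , _ , perm , edges≡ , alive≡) ◅ st) =
  trans (sym (∣remove∣ u∈)) (cong suc (trans (cong ∣_∣ (sym alive≡)) (proj₁ (suppression-counts st)))) ,
  trans (↭-length perm) (cong suc (trans (cong length (sym edges≡)) (proj₂ (suppression-counts st))))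

single-step : ∀ {n} {P Q : PState n} (st : Star SuppStep P Q) → steps st ≡ 1 → SuppStep P Q
single-step (s ◅ ε) refl = s

AlivePair : ∀ {n} → Subset n → Edge n → Set
AlivePair A p = proj₁ p ∈ A × proj₂ p ∈ A

-- the invariants of a state obtained from a simple graph that a suppression step needs
WellBehaved : ∀ {n} → PState n → Set
WellBehaved P = All NonLoop (edges P) × AllPairs Distinct (edges P) × All (AlivePair (alive P)) (edges P)

alive-touched : ∀ {n} {A : Subset n} {xs} → All (AlivePair A) xs → ∀ e v → Graph.Touches (lookup xs) e v → v ∈ A
alive-touched alive e v (inj₁ refl) = proj₁ (All-index alive e)
alive-touched alive e v (inj₂ refl) = proj₂ (All-index alive e)

pendant-ext : ∀ {n m} {ends₁ ends₂ : Fin m → Edge n} → (∀ i → ends₁ i ≡ ends₂ i)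
  → ∀ {y e₀ z} → Graph.Pendant ends₁ y e₀ z → Graph.Pendant ends₂ y e₀ z
pendant-ext same (j , y≢z , only) =
  subst (λ p → UEq p _) (same _) j , y≢z , λ e t → only e (subst (AtVertex _) (sym (same e)) t)

-- One suppression step, replacing {a, u}, {u, b} by {a, b}, read backwards is
-- the subdivision of {a, b} by u.
module SuppressionStep {n} {P₀ P₁ : PState n} (ss : SuppStep P₀ P₁) (good : WellBehaved P₀) where
  u : Fin n
  u = proj₁ ss
  u∈ : u ∈ alive P₀
  u∈ = proj₁ (proj₂ ss)
  deg-u : degL (edges P₀) u ≡ 2
  deg-u = proj₁ (proj₂ (proj₂ ss))
  a b : Fin n
  a = proj₁ (proj₂ (proj₂ (proj₂ ss)))
  b = proj₁ (proj₂ (proj₂ (proj₂ (proj₂ ss))))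
  e₁ e₂ : Edge n
  e₁ = proj₁ (proj₂ (proj₂ (proj₂ (proj₂ (proj₂ ss)))))
  e₂ = proj₁ (proj₂ (proj₂ (proj₂ (proj₂ (proj₂ (proj₂ ss))))))
  rest : List (Edge n)
  rest = proj₁ (proj₂ (proj₂ (proj₂ (proj₂ (proj₂ (proj₂ (proj₂ ss)))))))
  j₁ : UEq e₁ (a , u)
  j₁ = proj₁ (proj₂ (proj₂ (proj₂ (proj₂ (proj₂ (proj₂ (proj₂ (proj₂ ss))))))))
  j₂ : UEq e₂ (u , b)
  j₂ = proj₁ (proj₂ (proj₂ (proj₂ (proj₂ (proj₂ (proj₂ (proj₂ (proj₂ (proj₂ ss)))))))))
  perm : edges P₀ ↭ e₁ ∷ e₂ ∷ rest
  perm = proj₁ (proj₂ (proj₂ (proj₂ (proj₂ (proj₂ (proj₂ (proj₂ (proj₂ (proj₂ (proj₂ ss))))))))))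
  edges≡ : edges P₁ ≡ (a , b) ∷ rest
  edges≡ = proj₁ (proj₂ (proj₂ (proj₂ (proj₂ (proj₂ (proj₂ (proj₂ (proj₂ (proj₂ (proj₂ (proj₂ ss)))))))))))
  alive≡ : alive P₁ ≡ alive P₀ [ u ]≔ outside
  alive≡ = proj₂ (proj₂ (proj₂ (proj₂ (proj₂ (proj₂ (proj₂ (proj₂ (proj₂ (proj₂ (proj₂ (proj₂ ss)))))))))))

  private
    nonloops : All NonLoop (e₁ ∷ e₂ ∷ rest)
    nonloops = All-resp-↭ perm (proj₁ good)
    distinct : AllPairs Distinct (e₁ ∷ e₂ ∷ rest)
    distinct = AllPairs-↭ Distinct-sym (proj₁ (proj₂ good)) perm
    alive-ends : All (AlivePair (alive P₀)) (e₁ ∷ e₂ ∷ rest)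
    alive-ends = All-resp-↭ perm (proj₂ (proj₂ good))
    split : u ≢ a × u ≢ b × degL rest u ≡ 0
    split = degree-two e₁ e₂ rest (trans (sym (degL-↭ perm u)) deg-u) j₁ j₂

  u≢a : u ≢ a
  u≢a = proj₁ split
  u≢b : u ≢ b
  u≢b = proj₁ (proj₂ split)
  rest-u : degL rest u ≡ 0
  rest-u = proj₂ (proj₂ split)

  -- {a, u} and {u, b} are distinct edges, so a ≠ b
  a≢b : a ≢ b
  a≢b refl with distinct
  ... | (e₁≉e₂ ∷ _) ∷ _ = e₁≉e₂ (UEq-trans j₁ (UEq-trans (inj₂ refl) (UEq-sym j₂)))

  u-untouched : ∀ i → ¬ Graph.Touches (lookup rest) i u
  u-untouched = degL≡0⇒untouched rest u rest-u

  rest-loopless : Graph.Loopless (lookup rest)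
  rest-loopless with nonloops
  ... | _ ∷ _ ∷ rest-nonloops = All-index rest-nonloops

  degree-kept : ∀ y → y ≢ u → degL (edges P₁) y ≡ degL (edges P₀) y
  degree-kept y y≢u = trans (cong (λ es → degL es y) edges≡) (trans merged (sym (degL-↭ perm y)))
    where
    merged : degL ((a , b) ∷ rest) y ≡ degL (e₁ ∷ e₂ ∷ rest) y
    merged rewrite degL-cons e₁ (e₂ ∷ rest) y | degL-cons e₂ rest y | degP-UEq j₁ y | degP-UEq j₂ y
                 | ind-no {a = u} {v = y} (y≢u ∘ sym) =
      trans (ℕP.+-assoc (ind (a ≟ y)) (ind (b ≟ y)) (degL rest y))
        (cong (_+ (ind (b ≟ y) + degL rest y)) (sym (ℕP.+-identityʳ (ind (a ≟ y)))))

  alive-after : All (AlivePair (alive P₁)) (edges P₁)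
  alive-after = subst (All (AlivePair (alive P₁))) (sym edges≡)
    (subst (λ A → All (AlivePair A) ((a , b) ∷ rest)) (sym alive≡) (ab-alive ∷ rest-alive rest rest-u (drop₂ alive-ends)))
    where
    drop₂ : ∀ {A xs} → All (AlivePair A) (e₁ ∷ e₂ ∷ xs) → All (AlivePair A) xs
    drop₂ (_ ∷ _ ∷ all) = all
    a-alive : a ∈ alive P₀
    a-alive with alive-ends | j₁
    ... | (p∈ , q∈) ∷ _ | inj₁ refl = p∈
    ... | (p∈ , q∈) ∷ _ | inj₂ refl = q∈
    b-alive : b ∈ alive P₀
    b-alive with alive-ends | j₂
    ... | _ ∷ (p∈ , q∈) ∷ _ | inj₁ refl = q∈
    ... | _ ∷ (p∈ , q∈) ∷ _ | inj₂ refl = p∈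
    ab-alive : AlivePair (alive P₀ [ u ]≔ outside) (a , b)
    ab-alive = ∈-remove⁺ a-alive (u≢a ∘ sym) , ∈-remove⁺ b-alive (u≢b ∘ sym)
    rest-alive : ∀ xs → degL xs u ≡ 0 → All (AlivePair (alive P₀)) xs → All (AlivePair (alive P₀ [ u ]≔ outside)) xs
    rest-alive []             _     []                   = []
    rest-alive ((p , q) ∷ xs) deg≡0 ((p∈ , q∈) ∷ alive) =
      (∈-remove⁺ p∈ (ind≡0⇒≢ (ℕP.m+n≡0⇒m≡0 _ (ℕP.m+n≡0⇒m≡0 _ deg≡0))) ,
       ∈-remove⁺ q∈ (ind≡0⇒≢ (ℕP.m+n≡0⇒n≡0 (ind (p ≟ u)) (ℕP.m+n≡0⇒m≡0 _ deg≡0)))) ∷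
      rest-alive xs (ℕP.m+n≡0⇒n≡0 (ind (p ≟ u) + ind (q ≟ u)) deg≡0) alive

  open Subdivision (lookup rest) a u b

  before≅subdivided : EBij (Mapped id) (lookup (edges P₀)) subdivided
  before≅subdivided = ebij-trans (ebij-perm perm) halves (λ { refl r → r })
    where
    halves : EBij (Mapped id) (lookup (e₁ ∷ e₂ ∷ rest)) subdivided
    halves = record { f = id ; g = id ; gf = λ _ → refl ; fg = λ _ → refl ; rel = rel′ }
      where
      rel′ : ∀ i → UEq (subdivided i) (lookup (e₁ ∷ e₂ ∷ rest) i)
      rel′ zero          = UEq-sym j₁
      rel′ (suc zero)    = UEq-sym j₂
      rel′ (suc (suc i)) = inj₁ refl

  after≡direct : ∀ i → lookup ((a , b) ∷ rest) i ≡ direct i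
  after≡direct zero    = refl
  after≡direct (suc i) = refl

  direct≅after : EBij (Mapped id) direct (lookup (edges P₁))
  direct≅after = subst (λ es → EBij (Mapped id) direct (lookup es)) (sym edges≡)
    (record { f = id ; g = id ; gf = λ _ → refl ; fg = λ _ → refl ; rel = λ i → inj₁ (after≡direct i) })

  step-same-level : ∀ {y} → y ∈ alive P₁ → degL (edges P₁) y ≡ 1 → SameLevel (lookup (edges P₀)) (lookup (edges P₁))
  step-same-level {y} y∈ deg-y with degL≡1⇒pendant ((a , b) ∷ rest) y (subst (λ es → degL es y ≡ 1) edges≡ deg-y)
  ... | _ , _ , pendant =
    SameLevel-trans (relabel-same-level before≅subdivided)
      (SameLevel-trans (SameLevel-sym (Conditions.subdivision-same-level u≢a u≢b a≢b u-untouched rest-loopless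
                                        (pendant-ext after≡direct pendant) y≢u))
        (relabel-same-level direct≅after))
    where
    y≢u : y ≢ u
    y≢u = proj₂ (∈-remove⁻ (subst (y ∈_) alive≡ y∈))

UEq-at : ∀ {n} {p q : Edge n} {y} → UEq p q → AtVertex y q → AtVertex y p
UEq-at (inj₁ refl) at = at
UEq-at (inj₂ refl) (inj₁ eq) = inj₂ eq
UEq-at (inj₂ refl) (inj₂ eq) = inj₁ eq

pendant-back : ∀ {n m₁ m₂} {ends₁ : Fin m₁ → Edge n} {ends₂ : Fin m₂ → Edge n} (b : EBij (Mapped id) ends₁ ends₂)
  → ∀ {y e₀ z} → Graph.Pendant ends₂ y e₀ z → Graph.Pendant ends₁ y (EBij.g b e₀) z
pendant-back {ends₁ = ends₁} {ends₂} b {y} {e₀} {z} (j , y≢z , only) = j′ , y≢z , only′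
  where
  open EBij b
  j′ : UEq (ends₁ (g e₀)) (y , z)
  j′ = UEq-trans (UEq-sym (subst (λ k → UEq (ends₂ k) _) (fg e₀) (rel (g e₀)))) j
  only′ : ∀ e → Graph.Touches ends₁ e y → e ≡ g e₀
  only′ e t = trans (sym (gf e)) (cong g (only (f e) (UEq-at (rel e) t)))

deg≡1⇒pendant : ∀ {n m} (ends : Fin m → Edge n) y → deg ends y ≡ 1 → ∃[ e₀ ] ∃[ z ] Graph.Pendant ends y e₀ z
deg≡1⇒pendant ends y deg≡1 with degL≡1⇒pendant (tabulate ends) y (trans (sym (deg≡degL-tabulate ends y)) deg≡1)
... | e₀ , z , pendant = _ , z , pendant-back as-mapped pendant
  where
  as-mapped : EBij (Mapped id) ends (lookup (tabulate ends))
  as-mapped = record { f = f ; g = g ; gf = gf ; fg = fg ; rel = λ i → inj₁ (sym (rel i)) }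
    where open EBij (ebij-tabulate ends)

two-leaves⇒single-edge : ∀ {n m} (ends : Fin m → Edge n) → Connected ends
  → ∀ {v e₀ w e₁ z} → Graph.Pendant ends v e₀ w → Graph.Pendant ends w e₁ z → m ≡ 1
two-leaves⇒single-edge {n} {m} ends connected {v} {e₀} {w} {e₁} (j₀ , v≢w , only-v) (_ , _ , only-w) =
  ℕP.≤-antisym (subst₂ _≤_ (∣⊤∣≡n m) (∣⁅x⁆∣≡1 e₀) (p⊆q⇒∣p∣≤∣q∣ {p = S.⊤} (λ {e} _ → subst (_∈ S.⁅ e₀ ⁆) (sym (all-e₀ e)) (x∈⁅x⁆ e₀))))
               (one≤ e₀)
  where
  open Graph ends
  subst₂ : ∀ {A B : Set} (R : A → B → Set) {a a′ b b′} → a ≡ a′ → b ≡ b′ → R a b → R a′ b′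
  subst₂ R refl refl r = r
  one≤ : Fin m → 1 ≤ m
  one≤ zero    = s≤s z≤n
  one≤ (suc _) = s≤s z≤n
  e₁≡e₀ : e₁ ≡ e₀
  e₁≡e₀ = sym (only-w e₀ (joins-touches₂ j₀))
  only-e₀ : ∀ e x → Touches e x → x ≡ v ⊎ x ≡ w → e ≡ e₀
  only-e₀ e x t (inj₁ refl) = only-v e t
  only-e₀ e x t (inj₂ refl) = trans (only-w e t) e₁≡e₀
  stays : ∀ {P Q x y} → Walk ends P Q x y → x ≡ v ⊎ x ≡ w → y ≡ v ⊎ y ≡ w
  stays (here _) at = at
  stays (step e _ _ j r) (inj₁ refl) with only-v e (joins-touches₁ j)
  ... | refl = stays r (inj₂ (joins-other j₀ j refl))
  stays (step e _ _ j r) (inj₂ refl) with trans (only-w e (joins-touches₁ j)) e₁≡e₀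
  ... | refl = stays r (inj₁ (joins-other (joins-sym j₀) j refl))
  all-e₀ : ∀ e → e ≡ e₀
  all-e₀ e = only-e₀ e (proj₁ (ends e)) (inj₁ refl) (stays (connected v (proj₁ (ends e))) (inj₁ refl))

single-edge-level : ∀ {n m} (ends : Fin m → Edge n) → m ≡ 1 → Graph.Loopless ends → IsLevel ends (ℤ.+ 0)
single-edge-level ends refl loopless = bound , Graph.pendant-bicomp ends loopless pendant
  where
  pendant : Graph.Pendant ends (proj₁ (ends zero)) zero (proj₂ (ends zero))
  pendant = inj₁ refl , loopless zero , λ { zero _ → refl }
  bound : ∀ VS ES → BiComp ends VS ES → retSub ends VS ES ℤ.≤ ℤ.+ 0
  bound VS ES bc = subst (ℤ._≤ ℤ.+ 0)
    (sym (Graph.single-edge-ret ends loopless bc (ℕP.≤-antisym (∣p∣≤n ES) (proj₁ (proj₂ (proj₂ bc))))))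
    (ℤ.+≤+ z≤n)

-- Deleting a leaf v of a simple graph.  Its unique edge {v, w} goes, leaving
-- the edge list D of deleteV; adding {v, w} back to D recovers the graph.
module LeafDeletion {n m} (ends : Fin m → Edge n) (simple : Simple ends) (v : Fin n) (deg-v : deg ends v ≡ 1) where
  L : List (Edge n)
  L = map ends (allFin m)
  P₀ : PState n
  P₀ = deleteV ends v
  D : List (Edge n)
  D = edges P₀

  L-nonloops : All NonLoop L
  L-nonloops = simple-nonloops ends (proj₁ simple)

  singleton : ∀ {A : Set} (xs : List A) → length xs ≡ 1 → ∃[ x ] xs ≡ x ∷ []
  singleton (x ∷ []) _ = x , refl
  one-at-v : length (filter (at? v) L) ≡ 1
  one-at-v = trans (length-at L-nonloops v) (trans (sym (deg≡degL ends v)) deg-v)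
  pendant-edge : Edge n
  pendant-edge = proj₁ (singleton (filter (at? v) L) one-at-v)
  at-v≡ : filter (at? v) L ≡ pendant-edge ∷ []
  at-v≡ = proj₂ (singleton (filter (at? v) L) one-at-v)

  pendant-edge-at-v : AtVertex v pendant-edge
  pendant-edge-at-v with subst (All (AtVertex v)) at-v≡ (all-filter (at? v) L)
  ... | at ∷ [] = at
  pendant-edge-nonloop : NonLoop pendant-edge
  pendant-edge-nonloop with subst (All NonLoop) at-v≡ (All-filter⁺ (at? v) L-nonloops)
  ... | nonloop ∷ [] = nonloop

  neighbour : ∃[ w ] (v ≢ w × UEq pendant-edge (v , w))
  neighbour with pendant-edge-at-v
  ... | inj₁ e = proj₂ pendant-edge , (λ q → pendant-edge-nonloop (trans e q)) , inj₁ (cong (λ z → z , proj₂ pendant-edge) e)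
  ... | inj₂ e = proj₁ pendant-edge , (λ q → pendant-edge-nonloop (trans (sym q) (sym e))) , inj₂ (cong (λ z → proj₁ pendant-edge , z) e)
  w : Fin n
  w = proj₁ neighbour
  v≢w : v ≢ w
  v≢w = proj₁ (proj₂ neighbour)

  L↭ : L ↭ pendant-edge ∷ D
  L↭ = subst (λ es → L ↭ es ++ D) at-v≡ (partition-↭ (at? v) L)

  degree-deleted : ∀ y → v ≢ y → deg ends y ≡ ind (w ≟ y) + degL D y
  degree-deleted y v≢y = trans (deg≡degL ends y) (trans (degL-↭ L↭ y)
    (cong (_+ degL D y) (trans (degP-UEq (proj₂ (proj₂ neighbour)) y) (cong (_+ ind (w ≟ y)) (ind-no v≢y)))))

  v-untouched : All (λ p → ¬ AtVertex v p) D
  v-untouched = all-filter (¬? ∘ at? v) L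
  D-untouched : ∀ e → ¬ Graph.Touches (lookup D) e v
  D-untouched = All-index v-untouched
  D-loopless : Graph.Loopless (lookup D)
  D-loopless = All-index (All-filter⁺ (¬? ∘ at? v) L-nonloops)

  alive-≢v : ∀ {y} → v ≢ y → y ∈ alive P₀
  alive-≢v v≢y = ∈-remove⁺ ∈⊤ (v≢y ∘ sym)

  good : WellBehaved P₀
  good = All-filter⁺ (¬? ∘ at? v) L-nonloops ,
         AllPairsP.filter⁺ (¬? ∘ at? v) (simple-distinct ends (proj₂ simple)) ,
         All-map-alive v-untouched
    where
    All-map-alive : ∀ {xs} → All (λ p → ¬ AtVertex v p) xs → All (AlivePair (alive P₀)) xs
    All-map-alive []             = []
    All-map-alive (¬at ∷ ¬ats)   = (∈-remove⁺ ∈⊤ (¬at ∘ inj₁) , ∈-remove⁺ ∈⊤ (¬at ∘ inj₂)) ∷ All-map-alive ¬ats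

  vertices : suc ∣ alive P₀ ∣ ≡ n
  vertices = trans (∣remove∣ {p = S.⊤} {x = v} ∈⊤) (∣⊤∣≡n n)

  edge-count : suc (length D) ≡ m
  edge-count = trans (sym (↭-length L↭)) (trans (cong length (map-tabulate id ends)) (length-tabulate ends))

  restored : EBij (Mapped id) ends (AddPendant.ends₂ (lookup D) v w)
  restored = ebij-trans (ebij-trans (ebij-trans (ebij-tabulate ends) (ebij-perm (↭-reflexive (sym (map-tabulate id ends)))) trans)
                        (ebij-perm L↭) trans) head (λ { refl r → r })
    where
    head : EBij (Mapped id) (lookup (pendant-edge ∷ D)) (AddPendant.ends₂ (lookup D) v w)
    head = record { f = id ; g = id ; gf = λ _ → refl ; fg = λ _ → refl ; rel = rel′ }
      where
      rel′ : ∀ i → UEq (AddPendant.ends₂ (lookup D) v w i) (lookup (pendant-edge ∷ D) i)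
      rel′ zero    = UEq-sym (proj₂ (proj₂ neighbour))
      rel′ (suc i) = inj₁ refl

  pendant-v : ∃[ e₀ ] Graph.Pendant ends v e₀ w
  pendant-v = _ , pendant-back restored (AddPendant.pendant (lookup D) v w v≢w D-untouched D-loopless)

  deletion-same-level : Graph.ZeroBiComp (lookup D) → SameLevel ends (lookup D)
  deletion-same-level zero-D = SameLevel-trans (relabel-same-level restored)
    (SameLevel-sym (AddPendant.pendant-same-level (lookup D) v w v≢w D-untouched D-loopless zero-D))

  neighbour-leaf : Connected ends → deg ends w ≡ 1 → m ≡ 1
  neighbour-leaf connected deg-w with deg≡1⇒pendant ends w deg-w
  ... | _ , _ , pendant-w = two-leaves⇒single-edge ends connected (proj₂ pendant-v) pendant-w

  -- In a binary network with deg w = 3, the only degree-2 vertex after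
  -- deleting v is w, so the suppression is the single step at w.
  module Binary (binary : ∀ y → deg ends y ≡ 1 ⊎ deg ends y ≡ 3) (deg-w : deg ends w ≡ 3) where
    degree-kept : ∀ y → v ≢ y → y ≢ w → degL D y ≡ deg ends y
    degree-kept y v≢y y≢w = sym (trans (degree-deleted y v≢y) (cong (_+ degL D y) (ind-no (y≢w ∘ sym))))

    not-two : ∀ y → v ≢ y → y ≢ w → degL D y ≢ 2
    not-two y v≢y y≢w deg≡2 with binary y
    ... | inj₁ deg≡1 = 1≢2 (trans (sym deg≡1) (trans (sym (degree-kept y v≢y y≢w)) deg≡2))
      where 1≢2 : 1 ≢ 2
            1≢2 ()
    ... | inj₂ deg≡3 = 3≢2 (trans (sym deg≡3) (trans (sym (degree-kept y v≢y y≢w)) deg≡2))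
      where 3≢2 : 3 ≢ 2
            3≢2 ()

    w-two : degL D w ≡ 2
    w-two = ℕP.suc-injective (trans (sym (trans (degree-deleted w v≢w) (cong (_+ degL D w) (ind-yes {a = w} {v = w} refl)))) deg-w)

    alive⇒≢v : ∀ {y} → y ∈ alive P₀ → v ≢ y
    alive⇒≢v y∈ e = proj₂ (∈-remove⁻ y∈) (sym e)

    single-suppression : ∀ {P} (st : Star SuppStep P₀ P) → (∀ y → y ∈ alive P → degL (edges P) y ≢ 2)
      → Σ (SuppStep P₀ P) (λ ss → proj₁ ss ≡ w) × steps st ≡ 1
    single-suppression ε                 done = ⊥-elim (done w (alive-≢v v≢w) w-two)
    single-suppression (first ◅ further) done = finished further done
      where
      module First = SuppressionStep first good
      u≡w : First.u ≡ w
      u≡w with First.u ≟ w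
      ... | yes u≡w = u≡w
      ... | no  u≢w = ⊥-elim (not-two First.u (alive⇒≢v First.u∈) u≢w First.deg-u)
      finished : ∀ {P} (st : Star SuppStep _ P) → (∀ y → y ∈ alive P → degL (edges P) y ≢ 2)
        → Σ (SuppStep P₀ P) (λ ss → proj₁ ss ≡ w) × steps (first ◅ st) ≡ 1
      finished ε _ = (first , u≡w) , refl
      finished ((u₂ , u₂∈ , deg₂ , _) ◅ _) _ with ∈-remove⁻ (subst (u₂ ∈_) First.alive≡ u₂∈)
      ... | u₂∈₀ , u₂≢u = ⊥-elim (not-two u₂ (alive⇒≢v u₂∈₀) (λ e → u₂≢u (trans e (sym u≡w)))
                                     (trans (sym (First.degree-kept u₂ u₂≢u)) deg₂))

    leaf-survives : ∀ {P} (ss : SuppStep P₀ P) → proj₁ ss ≡ w → ∀ y → v ≢ y → deg ends y ≡ 1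
      → y ∈ alive P × degL (edges P) y ≡ 1
    leaf-survives {P} ss u≡w y v≢y deg-y = alive-y , trans (Step.degree-kept y y≢u) (trans (degree-kept y v≢y y≢w) deg-y)
      where
      module Step = SuppressionStep ss good
      y≢w : y ≢ w
      y≢w refl = 1≢3 (trans (sym deg-y) deg-w)
        where 1≢3 : 1 ≢ 3
              1≢3 ()
      y≢u : y ≢ Step.u
      y≢u y≡u = y≢w (trans y≡u u≡w)
      alive-y : y ∈ alive P
      alive-y = subst (y ∈_) (sym Step.alive≡) (∈-remove⁺ (alive-≢v v≢y) y≢u)

leaf-suppression-same-level : ∀ {n m} (ends : Fin m → Edge n) (simple : Simple ends) {v} (deg-v : deg ends v ≡ 1)
  → ∀ {P} (ss : SuppStep (deleteV ends v) P) → ∀ {y} → y ∈ alive P → degL (edges P) y ≡ 1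
  → SameLevel ends (lookup (edges P))
leaf-suppression-same-level ends simple {v} deg-v ss {y} y∈ deg-y =
  SameLevel-trans (deletion-same-level zero-D) (step-same-level y∈ deg-y)
  where
  open LeafDeletion ends simple v deg-v
  open SuppressionStep ss good
  y≢u : y ≢ u
  y≢u = proj₂ (∈-remove⁻ (subst (y ∈_) alive≡ y∈))
  zero-D : Graph.ZeroBiComp (lookup D)
  zero-D with degL≡1⇒pendant D y (trans (sym (degree-kept y y≢u)) deg-y)
  ... | _ , _ , pendant = Graph.pendant-bicomp (lookup D) D-loopless pendant

module PseudoIso {n k} {P P′ : PState n} {lab lab′ : Fin k → Fin n} {x} (iso : PIso P P′ lab lab′ x) where
  φ ψ : Fin n → Fin n
  φ = proj₁ iso
  ψ = proj₁ (proj₂ iso)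
  φ-alive : ∀ v → v ∈ alive P → φ v ∈ alive P′ × ψ (φ v) ≡ v
  φ-alive = proj₁ (proj₂ (proj₂ iso))
  ψ-alive : ∀ w → w ∈ alive P′ → ψ w ∈ alive P × φ (ψ w) ≡ w
  ψ-alive = proj₁ (proj₂ (proj₂ (proj₂ iso)))

  edge-image : ∃[ es ] (Pointwise (λ e f → UEq (×-map φ φ e) f) (edges P) es × es ↭ edges P′)
  edge-image = proj₁ (proj₂ (proj₂ (proj₂ (proj₂ iso))))

  vertex-count : ∣ alive P ∣ ≡ ∣ alive P′ ∣
  vertex-count = bijection-∣≡∣ (alive P) (alive P′) φ ψ φ-alive ψ-alive

  edge-count : length (edges P) ≡ length (edges P′)
  edge-count = trans (Pointwise-length (proj₁ (proj₂ edge-image))) (↭-length (proj₂ (proj₂ edge-image)))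

  edge-bijection : EBij (Mapped φ) (lookup (edges P)) (lookup (edges P′))
  edge-bijection = ebij-trans (ebij-pointwise (proj₁ (proj₂ edge-image))) (ebij-perm (proj₂ (proj₂ edge-image)))
                     (λ { r refl → UEq-sym r })

  same-level : All (AlivePair (alive P)) (edges P) → All (AlivePair (alive P′)) (edges P′)
    → SameLevel (lookup (edges P)) (lookup (edges P′))
  same-level alive alive′ = iso-same-level φ ψ edge-bijection
    (λ e v t → proj₂ (φ-alive v (alive-touched alive e v t)))
    (λ e v t → proj₂ (ψ-alive v (alive-touched alive′ e v t)))

  private
    ind-φ : ∀ {a y} → a ∈ alive P → y ∈ alive P → ind (φ a ≟ φ y) ≡ ind (a ≟ y)
    ind-φ {a} {y} a∈ y∈ with a ≟ y
    ... | yes refl = ind-yes refl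
    ... | no  a≢y  = ind-no (λ e → a≢y (trans (sym (proj₂ (φ-alive a a∈))) (trans (cong ψ e) (proj₂ (φ-alive y y∈)))))

    pointwise-degree : ∀ y → y ∈ alive P → ∀ {xs ys} → Pointwise (λ e f → UEq (×-map φ φ e) f) xs ys
      → All (AlivePair (alive P)) xs → degL ys (φ y) ≡ degL xs y
    pointwise-degree y y∈ [] [] = refl
    pointwise-degree y y∈ {(p , q) ∷ xs} {r ∷ ys} (p≈r ∷ rest) ((p∈ , q∈) ∷ alive) =
      trans (degL-cons r ys (φ y))
        (cong₂ _+_ (trans (sym (degP-UEq p≈r (φ y))) (cong₂ _+_ (ind-φ p∈ y∈) (ind-φ q∈ y∈)))
                   (pointwise-degree y y∈ rest alive))

  degree : All (AlivePair (alive P)) (edges P) → ∀ y → y ∈ alive P → degL (edges P′) (φ y) ≡ degL (edges P) y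
  degree alive y y∈ = trans (sym (degL-↭ (proj₂ (proj₂ edge-image)) (φ y))) (pointwise-degree y y∈ (proj₁ (proj₂ edge-image)) alive)

reconstruction-sizes : ∀ {n m m′ : ℕ} {P₀ P₀′ P P′ : PState n} (st : Star SuppStep P₀ P) (st′ : Star SuppStep P₀′ P′)
  → suc ∣ alive P₀ ∣ ≡ n → suc ∣ alive P₀′ ∣ ≡ n
  → suc (length (edges P₀)) ≡ m → suc (length (edges P₀′)) ≡ m′
  → ∣ alive P ∣ ≡ ∣ alive P′ ∣ → length (edges P) ≡ length (edges P′)
  → steps st ≡ steps st′ × m ≡ m′
reconstruction-sizes {n} {m} {m′} {P₀} {P₀′} {P} {P′} st st′ n≡ n≡′ m≡ m≡′ same-alive same-edges = same-steps , same-m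
  where
  open ≡-Reasoning
  same-steps : steps st ≡ steps st′
  same-steps = ℕP.+-cancelʳ-≡ ∣ alive P ∣ (steps st) (steps st′) (ℕP.suc-injective (begin
    suc (steps st + ∣ alive P ∣)     ≡⟨ cong suc (sym (proj₁ (suppression-counts st))) ⟩
    suc ∣ alive P₀ ∣                 ≡⟨ trans n≡ (sym n≡′) ⟩
    suc ∣ alive P₀′ ∣                ≡⟨ cong suc (proj₁ (suppression-counts st′)) ⟩
    suc (steps st′ + ∣ alive P′ ∣)   ≡⟨ cong (λ (a : ℕ) → suc (steps st′ + a)) (sym same-alive) ⟩
    suc (steps st′ + ∣ alive P ∣)    ∎))
  same-m : m ≡ m′
  same-m = begin
    m                                    ≡⟨ sym m≡ ⟩
    suc (length (edges P₀))              ≡⟨ cong suc (proj₂ (suppression-counts st)) ⟩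
    suc (steps st + length (edges P))    ≡⟨ cong₂ (λ (s e : ℕ) → suc (s + e)) same-steps same-edges ⟩
    suc (steps st′ + length (edges P′))  ≡⟨ cong suc (sym (proj₂ (suppression-counts st′))) ⟩
    suc (length (edges P₀′))             ≡⟨ m≡′ ⟩
    m′                                   ∎

single-edge-levels : ∀ {n m m′} (ends : Fin m → Edge n) (ends′ : Fin m′ → Edge n) → m ≡ 1 → m ≡ m′
  → Graph.Loopless ends → Graph.Loopless ends′ → ∃[ l ] (IsLevel ends l × IsLevel ends′ l)
single-edge-levels ends ends′ refl refl loopless loopless′ =
  ℤ.+ 0 , single-edge-level ends refl loopless , single-edge-level ends′ refl loopless′

suppressed-level : ∀ {k n m m′} (ends : Fin m → Edge n) (ends′ : Fin m′ → Edge n) {lab lab′ : Fin k → Fin n} {x y}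
  (simple : Simple ends) (simple′ : Simple ends′) (x-leaf : deg ends (lab x) ≡ 1) (x-leaf′ : deg ends′ (lab′ x) ≡ 1)
  → deg ends y ≡ 1 → lab x ≢ y → (∀ v → deg ends v ≡ 1 ⊎ deg ends v ≡ 3)
  → deg ends (LeafDeletion.w ends simple (lab x) x-leaf) ≡ 3
  → ∀ {P P′} (st : Star SuppStep (deleteV ends (lab x)) P) → (∀ v → v ∈ alive P → degL (edges P) v ≢ 2)
  → (st′ : Star SuppStep (deleteV ends′ (lab′ x)) P′) → steps st ≡ steps st′ → PIso P P′ lab lab′ x
  → ∃[ l ] (IsLevel ends l × IsLevel ends′ l)
suppressed-level ends ends′ {lab} {lab′} {x} {y} simple simple′ x-leaf x-leaf′ y-leaf x≢y binary w-deg3 {P} {P′}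
  st done st′ same-steps iso with LeafDeletion.Binary.single-suppression ends simple (lab x) x-leaf binary w-deg3 st done
... | (ss , u≡w) , one = proj₁ level-N , proj₂ level-N , proj₂ N′≈P′ (proj₁ P≈P′ (proj₁ N≈P (proj₂ level-N)))
  where
  module N  = LeafDeletion ends simple (lab x) x-leaf
  module N′ = LeafDeletion ends′ simple′ (lab′ x) x-leaf′
  module I  = PseudoIso iso
  ss′ : SuppStep N′.P₀ P′
  ss′ = single-step st′ (trans (sym same-steps) one)
  y-survives : y ∈ alive P × degL (edges P) y ≡ 1
  y-survives = N.Binary.leaf-survives binary w-deg3 ss u≡w y x≢y y-leaf
  alive-P : All (AlivePair (alive P)) (edges P)
  alive-P = SuppressionStep.alive-after ss N.good
  N≈P : SameLevel ends (lookup (edges P))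
  N≈P = leaf-suppression-same-level ends simple x-leaf ss (proj₁ y-survives) (proj₂ y-survives)
  P≈P′ : SameLevel (lookup (edges P)) (lookup (edges P′))
  P≈P′ = I.same-level alive-P (SuppressionStep.alive-after ss′ N′.good)
  N′≈P′ : SameLevel ends′ (lookup (edges P′))
  N′≈P′ = leaf-suppression-same-level ends′ simple′ x-leaf′ ss′ (proj₁ (I.φ-alive y (proj₁ y-survives)))
            (trans (I.degree alive-P y (proj₁ y-survives)) (proj₂ y-survives))
  level-N : ∃[ l ] IsLevel ends l
  level-N = pendant-level-exists ends (proj₁ simple) (proj₂ N.pendant-v)

proposition3p2 : ∀ {k n m m' : ℕ}
    (ends : Fin m → Fin n × Fin n) (lab : Fin k → Fin n)
    (ends' : Fin m' → Fin n × Fin n) (lab' : Fin k → Fin n)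
    → 2 ≤ k
    → BinaryPhyloNetwork ends lab
    → LeafReconstruction ends lab ends' lab'
    → (m ≡ m') × (n ≡ n) × (retNum n m ≡ retNum n m')
    × (∃[ l ] (IsLevel ends l × IsLevel ends' l))
proposition3p2 {suc (suc k)} {n} {m} {m'} ends lab ends' lab' (s≤s (s≤s _))
  ((connected , simple , (lab-injective , leaves) , _) , binary) ((_ , simple' , (_ , leaves') , _) , reconstructs)
  with reconstructs zero
... | P , P′ , (st , done) , (st′ , _) , iso = m≡m′ , refl , cong (retNum n) m≡m′ , level
  where
  -- delete the leaf x = zero on both sides; y = suc zero is a second leaf
  leaf : ∀ i → deg ends (lab i) ≡ 1
  leaf i = proj₂ (leaves (lab i)) (i , refl)
  leaf′ : ∀ i → deg ends' (lab' i) ≡ 1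
  leaf′ i = proj₂ (leaves' (lab' i)) (i , refl)
  module N = LeafDeletion ends simple (lab zero) (leaf zero)
  sizes : steps st ≡ steps st′ × m ≡ m'
  sizes = reconstruction-sizes {P₀ = N.P₀} {deleteV ends' (lab' zero)} st st′ N.vertices
            (LeafDeletion.vertices ends' simple' (lab' zero) (leaf′ zero)) N.edge-count
            (LeafDeletion.edge-count ends' simple' (lab' zero) (leaf′ zero)) (PseudoIso.vertex-count iso) (PseudoIso.edge-count iso)
  m≡m′ : m ≡ m'
  m≡m′ = proj₂ sizes
  x≢y : lab zero ≢ lab (suc zero)
  x≢y e with lab-injective e
  ... | ()
  level : ∃[ l ] (IsLevel ends l × IsLevel ends' l)
  level with binary N.w
  ... | inj₁ w-leaf = single-edge-levels ends ends' (N.neighbour-leaf connected w-leaf) m≡m′ (proj₁ simple) (proj₁ simple')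
  ... | inj₂ w-deg3 = suppressed-level ends ends' simple simple' (leaf zero) (leaf′ zero) (leaf (suc zero)) x≢y
                        binary w-deg3 st done st′ (proj₁ sizes) iso
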